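{- For every $n\ge 1$ there is a bijection between the set $\mathcal{L}^w(n,n)$ of weighted $(n,n)$ Delannoy paths and the set of skew-symmetric $(n,n)$-clans. In particular, the number $Z_n$ of skew-symmetric $(n,n)$-clans equals $|\mathcal{L}^w(n,n)|$.
   Context: An $(n,n)$-clan is a string $\gamma=c_1\cdots c_{2n}$ of symbols from $\mathbb{N}\cup\{+,-\}$ such that each natural number appearing in $\gamma$ appears exactly twice, and the number of $+$'s equals the number of $-$'s; two clans are equal if they have the same $\pm$ symbols in the same positions and the same sets of positions of matching pairs of natural numbers. With $rev(\gamma)=c_{2n}\cdots c_1$ and $-\gamma$ obtained by interchanging $+$ and $-$, $\gamma$ is skew-symmetric if $\gamma=-rev(\gamma)$. An $(n,n)$ Delannoy path is a word in the alphabet $\{N,E,D\}$ in which (number of $N$'s) + (number of $D$'s) = (number of $E$'s) + (number of $D$'s) = $n$ (a lattice path from $(0,0)$ to $(n,n)$ with north, east and northeast diagonal unit steps). A labeled step is a pair $(L,l)$ with $L\in\{N,E,D\}$ and $l$ a positive integer, where $l=1$ if $L\in\{N,E\}$. A weighted $(n,n)$ Delannoy path is a word $W=W_1\cdots W_r$ of labeled steps $W_i=(L_i,l_i)$ such that: (1) $L_1\cdots L_r$ is an $(n,n)$ Delannoy path; (2) letting $W_{i_1}\cdots W_{i_t}$ ($i_1<\dots<i_t$) be the subword of all steps that are not equal to $(D,1)$, $t$ is even, and if $W_i=(D,1)$ then $i>i_{t/2}$; (3) for $1\le j\le t$, if $L_{i_j}=N$ then $L_{i_{t+1-j}}=E$,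 and if $L_{i_j}=E$ then $L_{i_{t+1-j}}=N$; (4) setting $d_i=\#\{k>i\mid W_k=(D,1)\}$ and $m_i=\#\{k<i\mid l_k\ne 1\}$, for each $1\le j\le t/2$ with $l_{i_j}\neq 1$ (so $L_{i_j}=D$) we have $W_{i_{t+1-j}}=\big(D,\;2n+3-2(i_j+m_{i_j}+d_{i_{t+1-j}})-l_{i_j}\big)$. $\mathcal{L}^w(n,n)$ denotes the set of all weighted $(n,n)$ Delannoy paths. -}

module Defs where

open import Data.Nat using (ℕ; zero; suc; _+_; _*_; _∸_; _≤_; _<_; _/_; _%_)
open import Data.Integer as ℤ using (ℤ; +_)
open import Data.Fin using (Fin; opposite)
open import Data.Fin.Properties using () renaming (_≟_ to _≟ᶠ_)
open import Data.Vec using (Vec; lookup) renaming ([] to []ᵛ; _∷_ to _∷ᵛ_)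
open import Data.List using (List; []; _∷_; length; drop; take)
open import Data.Product using (Σ; _×_; _,_; proj₁; proj₂)
open import Data.Unit using (⊤)
open import Relation.Nullary using (¬_)
open import Relation.Nullary.Decidable using (False)
open import Relation.Binary.PropositionalEquality using (_≡_; _≢_)
import Relation.Binary.PropositionalEquality as ≡
open import Relation.Binary.Bundles using (Setoid)
import Relation.Binary.Construct.On as On

-- A clan of length m is encoded canonically: at each position there is
-- either a +, a -, or a natural number; a natural number is recorded by
-- the position of the other occurrence of the same number (`pr j`).
-- This is exactly the paper's notion of equality of clans (same ± in the
-- same positions, same sets of positions of matching pairs).
data Sym (m : ℕ) : Set where
  plus minus : Sym m
  pr         : Fin m → Sym m

-- condition on position i carrying the symbol s:
-- if s is a number, its partner is a different position j which carries
-- the same number (i.e. points back to i).  Hence each number appears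
-- exactly twice.
PairOK : ∀ {m} → Vec (Sym m) m → Fin m → Sym m → Set
PairOK v i plus   = ⊤
PairOK v i minus  = ⊤
PairOK v i (pr j) = False (i ≟ᶠ j) × lookup v j ≡ pr i

#plus : ∀ {m k} → Vec (Sym m) k → ℕ
#plus []ᵛ = 0
#plus (plus ∷ᵛ v) = suc (#plus v)
#plus (_    ∷ᵛ v) = #plus v

#minus : ∀ {m k} → Vec (Sym m) k → ℕ
#minus []ᵛ = 0
#minus (minus ∷ᵛ v) = suc (#minus v)
#minus (_     ∷ᵛ v) = #minus v

IsClan : (n : ℕ) → Vec (Sym (2 * n)) (2 * n) → Set
IsClan n v = (∀ i → PairOK v i (lookup v i)) × #plus v ≡ #minus v

-- the symbol at position i of  -rev(γ)  is  negRev (γ at position rev i)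
-- (rev i = opposite i): + and - are swapped, and a matching partner at
-- position j becomes a partner at position rev j.
negRev : ∀ {m} → Sym m → Sym m
negRev plus   = minus
negRev minus  = plus
negRev (pr j) = pr (opposite j)

IsSkewSymmetric : ∀ {m} → Vec (Sym m) m → Set
IsSkewSymmetric v = ∀ i → lookup v i ≡ negRev (lookup v (opposite i))

SkewClan : ℕ → Set
SkewClan n = Σ (Vec (Sym (2 * n)) (2 * n)) λ v → IsClan n v × IsSkewSymmetric v

SkewClanSetoid : ℕ → Setoid _ _
SkewClanSetoid n = On.setoid (≡.setoid (Vec (Sym (2 * n)) (2 * n))) (proj₁ {B = λ v → IsClan n v × IsSkewSymmetric v})

data Letter : Set where
  N E D : Letter

Step : Set
Step = Letter × ℕ

LabelOK : Step → Set
LabelOK (N , l) = l ≡ 1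
LabelOK (E , l) = l ≡ 1
LabelOK (D , l) = 1 ≤ l

letter : Step → Letter
letter = proj₁

label : Step → ℕ
label = proj₂

data IsD1 : Step → Set where
  isD1 : IsD1 (D , 1)

#N #E #D : List Step → ℕ
#N [] = 0
#N ((N , _) ∷ W) = suc (#N W)
#N (_ ∷ W) = #N W
#E [] = 0
#E ((E , _) ∷ W) = suc (#E W)
#E (_ ∷ W) = #E W
#D [] = 0
#D ((D , _) ∷ W) = suc (#D W)
#D (_ ∷ W) = #D W

#D1 : List Step → ℕ
#D1 [] = 0
#D1 ((D , suc zero) ∷ W) = suc (#D1 W)
#D1 (_ ∷ W) = #D1 W

#l≠1 : List Step → ℕ
#l≠1 [] = 0
#l≠1 ((_ , suc zero) ∷ W) = #l≠1 W
#l≠1 (_ ∷ W) = suc (#l≠1 W)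

-- W_i, with 1-based positions i (1 ≤ i ≤ length W);
-- the default value is only returned for out-of-range positions.
at : List Step → ℕ → Step
at [] _ = (D , 1)
at (s ∷ W) zero = (D , 1)
at (s ∷ W) (suc zero) = s
at (s ∷ W) (suc (suc k)) = at W (suc k)

nonD1From : ℕ → List Step → List ℕ
nonD1From k [] = []
nonD1From k ((D , suc zero) ∷ W) = nonD1From (suc k) W
nonD1From k (s ∷ W) = k ∷ nonD1From (suc k) W

nonD1Pos : List Step → List ℕ
nonD1Pos = nonD1From 1

tOf : List Step → ℕ
tOf W = length (nonD1Pos W)

nth : List ℕ → ℕ → ℕ
nth [] _ = 0
nth (x ∷ xs) zero = x
nth (x ∷ xs) (suc k) = nth xs k

-- i_j for 1 ≤ j ≤ t; we set i_0 = 0 (only used when t = 0, making the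
-- condition "i > i_{t/2}" vacuous, as all positions are ≥ 1)
idx : List Step → ℕ → ℕ
idx W zero = 0
idx W (suc j) = nth (nonD1Pos W) j

-- d_i = #{k > i | W_k = (D,1)}
dOf : List Step → ℕ → ℕ
dOf W i = #D1 (drop i W)

-- m_i = #{k < i | l_k ≠ 1}
mOf : List Step → ℕ → ℕ
mOf W i = #l≠1 (take (i ∸ 1) W)

record IsWeightedDelannoy (n : ℕ) (W : List Step) : Set where
  field
    labels  : ∀ i → 1 ≤ i → i ≤ length W → LabelOK (at W i)
    countNE : #N W + #D W ≡ n
    countED : #E W + #D W ≡ n
    tEven   : tOf W % 2 ≡ 0
    d1After : ∀ i → 1 ≤ i → i ≤ length W → IsD1 (at W i) →
              idx W (tOf W / 2) < i
    NtoE    : ∀ j → 1 ≤ j → j ≤ tOf W →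
              letter (at W (idx W j)) ≡ N →
              letter (at W (idx W (tOf W + 1 ∸ j))) ≡ E
    EtoN    : ∀ j → 1 ≤ j → j ≤ tOf W →
              letter (at W (idx W j)) ≡ E →
              letter (at W (idx W (tOf W + 1 ∸ j))) ≡ N
    weights : ∀ j → 1 ≤ j → j ≤ tOf W / 2 →
              label (at W (idx W j)) ≢ 1 →
              letter (at W (idx W (tOf W + 1 ∸ j))) ≡ D ×
              (+ label (at W (idx W (tOf W + 1 ∸ j)))) ≡
                ((+ (2 * n + 3)
                   ℤ.- + (2 * (idx W j + mOf W (idx W j)
                               + dOf W (idx W (tOf W + 1 ∸ j))))
                   ℤ.- + label (at W (idx W j))))

WeightedDelannoy : ℕ → Set
WeightedDelannoy n = Σ (List Step) (IsWeightedDelannoy n)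

WeightedDelannoySetoid : ℕ → Setoid _ _
WeightedDelannoySetoid n = On.setoid (≡.setoid (List Step)) (proj₁ {B = IsWeightedDelannoy n})

module Submission where

-- Both sets are described by one grammar, Skeleton.  A weighted path either
-- ends with (D,1), or its outermost steps other than (D,1) form a pair N…E,
-- E…N or (D,a+2)…(D,b+2) around a weighted path of size n with a + b = 2n + 1.
-- Both operations preserve and reflect conditions (1)-(4): dropping a final
-- (D,1) lowers every d_i by one, and removing an outer pair shifts positions
-- and the m_i uniformly.  The 2n + 2 values of a are indexed by Bool × Fin (n+1).
-- A skew-symmetric clan is determined by its left half, whose first symbol is
-- +, −, a number matched at its mirror position, or a number matched with one
-- of the n + 1 other left positions or with its mirror; deleting the positions
-- involved leaves a smaller half.  Matching (D,1) with +, N…E with −, E…N with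
-- a mirrored number and the diagonal pair (b , k) with a number matched at the
-- k-th other position (its mirror if b) gives the bijection.

open import Defs
open import Data.Nat as ℕ using (ℕ; zero; suc; _+_; _*_; _∸_; _≤_; _<_; z≤n; s≤s; _/_; _%_)
import Data.Nat.Properties as ℕ
open import Data.Nat.Induction using (<-rec)
open import Data.Nat.DivMod using (m/n≤m; m/n≡1+[m∸n]/n; [m+n]%n≡m%n)
open import Data.Nat.Tactic.RingSolver using (solve-∀)
open import Data.Integer as ℤ using (_⊖_) renaming (+_ to pos)
import Data.Integer.Properties as ℤ
open import Data.Fin using (Fin; zero; suc; toℕ; fromℕ<; _↑ˡ_; opposite; punchIn; punchOut)
open import Data.Fin.Properties
  using (_≟_; suc-injective; toℕ-injective; toℕ<n; toℕ-fromℕ<; toℕ-↑ˡ; opposite-prop; opposite-involutive;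
         punchIn-injective; punchInᵢ≢i; punchIn-punchOut; punchOut-punchIn; punchOut-cong)
open import Data.Fin.Permutation using (reverse)
open import Algebra.Properties.CommutativeMonoid.Sum ℕ.+-0-commutativeMonoid using (sum; sum-cong-≗; sum-permute)
open import Data.List using (List; []; _∷_; _++_; [_]; _∷ʳ_; length; map; take; drop; initLast; _∷ʳ′_)
import Data.List.Properties as List
open import Data.List.Relation.Unary.All as All using (All; []; _∷_)
open import Data.Vec using (Vec; lookup; tabulate; []; _∷_)
open import Data.Vec.Properties using (lookup∘tabulate; tabulate-cong; tabulate∘lookup)
open import Data.Bool using (Bool; true; false)
open import Data.Product using (Σ; _×_; _,_; proj₁; proj₂)
open import Data.Sum using (_⊎_; inj₁; inj₂)
open import Data.Empty using (⊥-elim)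
open import Data.Unit using (⊤; tt)
open import Relation.Nullary using (¬_; Dec; yes; no)
open import Relation.Nullary.Decidable using (False; fromWitnessFalse; toWitnessFalse)
open import Relation.Binary.PropositionalEquality hiding ([_])
open import Relation.Binary.Bundles using (Setoid)
import Relation.Binary.Construct.On as On
open import Function using (_∘_)
open import Function.Bundles using (Bijection; Inverse)
open import Function.Properties.Inverse using (Inverse⇒Bijection)
import Function.Construct.Composition as Compose
import Function.Construct.Symmetry as Symmetry

data Skeleton : ℕ → Set where
  nil    : Skeleton 0
  snocD1 : ∀ {n} → Skeleton n → Skeleton (suc n)
  wrapNE : ∀ {n} → Skeleton n → Skeleton (suc n)
  wrapEN : ∀ {n} → Skeleton n → Skeleton (suc n)
  wrapDD : ∀ {n} → Bool → Fin (suc n) → Skeleton n → Skeleton (suc (suc n))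

-- Weighted Delannoy paths

A-B-l≡A⊖[B+l] : ∀ A B l → (pos A ℤ.- pos B) ℤ.- pos l ≡ A ⊖ (B + l)
A-B-l≡A⊖[B+l] A B l = begin
  (pos A ℤ.- pos B) ℤ.- pos l            ≡⟨ ℤ.+-assoc (pos A) (ℤ.- pos B) (ℤ.- pos l) ⟩
  pos A ℤ.+ (ℤ.- pos B ℤ.+ ℤ.- pos l)    ≡⟨ cong (λ z → pos A ℤ.+ z) (sym (ℤ.neg-distrib-+ (pos B) (pos l))) ⟩
  pos A ℤ.+ ℤ.- (pos B ℤ.+ pos l)        ≡⟨ cong (λ z → pos A ℤ.- z) (sym (ℤ.pos-+ B l)) ⟩
  pos A ℤ.- pos (B + l)                  ≡⟨ ℤ.m-n≡m⊖n A (B + l) ⟩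
  A ⊖ (B + l)                            ∎
  where open ≡-Reasoning

+x≡A-B-l⇒x+[B+l]≡A : ∀ x A B l → pos x ≡ (pos A ℤ.- pos B) ℤ.- pos l → x + (B + l) ≡ A
+x≡A-B-l⇒x+[B+l]≡A x A B l e with ℕ.≤-<-connex (B + l) A
... | inj₁ B+l≤A = begin
  x + (B + l)             ≡⟨ cong (_+ (B + l)) (ℤ.+-injective (trans e (trans (A-B-l≡A⊖[B+l] A B l) (ℤ.⊖-≥ B+l≤A)))) ⟩
  (A ∸ (B + l)) + (B + l) ≡⟨ ℕ.m∸n+n≡m B+l≤A ⟩
  A                       ∎
  where open ≡-Reasoning
... | inj₂ A<B+l with trans (cong ℤ.sign (trans e (A-B-l≡A⊖[B+l] A B l))) (ℤ.sign-⊖-< A<B+l)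
... | ()

x+[B+l]≡A⇒+x≡A-B-l : ∀ x A B l → x + (B + l) ≡ A → pos x ≡ (pos A ℤ.- pos B) ℤ.- pos l
x+[B+l]≡A⇒+x≡A-B-l x A B l e = begin
  pos x                           ≡⟨ cong pos (sym (ℕ.m+n∸n≡m x (B + l))) ⟩
  pos ((x + (B + l)) ∸ (B + l))   ≡⟨ cong (λ z → pos (z ∸ (B + l))) e ⟩
  pos (A ∸ (B + l))               ≡⟨ ℤ.⊖-≥ (subst (B + l ≤_) e (ℕ.m≤n+m (B + l) x)) ⟨
  A ⊖ (B + l)                     ≡⟨ A-B-l≡A⊖[B+l] A B l ⟨
  (pos A ℤ.- pos B) ℤ.- pos l     ∎
  where open ≡-Reasoning

D1 : Step
D1 = (D , 1)

isD1? : (s : Step) → Dec (IsD1 s)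
isD1? (N , l)           = no λ ()
isD1? (E , l)           = no λ ()
isD1? (D , zero)        = no λ ()
isD1? (D , suc zero)    = yes isD1
isD1? (D , suc (suc l)) = no λ ()

nonD1From-∷ : ∀ k {s} W → ¬ IsD1 s → nonD1From k (s ∷ W) ≡ k ∷ nonD1From (suc k) W
nonD1From-∷ k {N , l}           W _  = refl
nonD1From-∷ k {E , l}           W _  = refl
nonD1From-∷ k {D , zero}        W _  = refl
nonD1From-∷ k {D , suc zero}    W ¬d = ⊥-elim (¬d isD1)
nonD1From-∷ k {D , suc (suc l)} W _  = refl

nonD1From-single : ∀ {s} k → ¬ IsD1 s → nonD1From k [ s ] ≡ [ k ]
nonD1From-single k = nonD1From-∷ k []

nonD1From-++ : ∀ k xs ys → nonD1From k (xs ++ ys) ≡ nonD1From k xs ++ nonD1From (k + length xs) ys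
nonD1From-++ k [] ys = cong (λ z → nonD1From z ys) (sym (ℕ.+-identityʳ k))
nonD1From-++ k (s ∷ xs) ys with isD1? s
... | yes isD1 = trans (nonD1From-++ (suc k) xs ys) (cong (λ z → nonD1From (suc k) xs ++ nonD1From z ys) (sym (ℕ.+-suc k (length xs))))
... | no ¬d = begin
  nonD1From k (s ∷ xs ++ ys)                                     ≡⟨ nonD1From-∷ k (xs ++ ys) ¬d ⟩
  k ∷ nonD1From (suc k) (xs ++ ys)                               ≡⟨ cong (k ∷_) (nonD1From-++ (suc k) xs ys) ⟩
  k ∷ (nonD1From (suc k) xs ++ nonD1From (suc k + length xs) ys) ≡⟨ cong (λ z → k ∷ (nonD1From (suc k) xs ++ nonD1From z ys)) (sym (ℕ.+-suc k (length xs))) ⟩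
  (k ∷ nonD1From (suc k) xs) ++ nonD1From (k + length (s ∷ xs)) ys ≡⟨ cong (_++ nonD1From (k + length (s ∷ xs)) ys) (sym (nonD1From-∷ k xs ¬d)) ⟩
  nonD1From k (s ∷ xs) ++ nonD1From (k + length (s ∷ xs)) ys     ∎
  where open ≡-Reasoning

nonD1From-suc : ∀ k W → nonD1From (suc k) W ≡ map suc (nonD1From k W)
nonD1From-suc k [] = refl
nonD1From-suc k (s ∷ W) with isD1? s
... | yes isD1 = nonD1From-suc (suc k) W
... | no ¬d    = trans (nonD1From-∷ (suc k) W ¬d)
                   (trans (cong (suc k ∷_) (nonD1From-suc (suc k) W)) (cong (map suc) (sym (nonD1From-∷ k W ¬d))))

private
  weaken : ∀ {k L p} → suc k ≤ p × p < suc k + L → k ≤ p × p < k + suc L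
  weaken {k} {L} {p} (k<p , p<) = ℕ.<⇒≤ k<p , subst (p <_) (sym (ℕ.+-suc k L)) p<

nonD1From-bounds : ∀ k W → All (λ p → k ≤ p × p < k + length W) (nonD1From k W)
nonD1From-bounds k [] = []
nonD1From-bounds k (s ∷ W) with isD1? s
... | yes isD1 = All.map weaken (nonD1From-bounds (suc k) W)
... | no ¬d    = subst (All _) (sym (nonD1From-∷ k W ¬d))
  ((ℕ.≤-refl , subst (k <_) (sym (ℕ.+-suc k (length W))) (s≤s (ℕ.m≤m+n k (length W))))
   ∷ All.map weaken (nonD1From-bounds (suc k) W))

All-nth : ∀ {P : ℕ → Set} {xs} j → All P xs → j < length xs → P (nth xs j)
All-nth zero    (px ∷ _) _         = px
All-nth (suc j) (_ ∷ ps) (s≤s j<) = All-nth j ps j<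

nth-++ˡ : ∀ xs ys j → j < length xs → nth (xs ++ ys) j ≡ nth xs j
nth-++ˡ (x ∷ xs) ys zero    _         = refl
nth-++ˡ (x ∷ xs) ys (suc j) (s≤s j<) = nth-++ˡ xs ys j j<

nth-++-length : ∀ xs y ys → nth (xs ++ y ∷ ys) (length xs) ≡ y
nth-++-length []       y ys = refl
nth-++-length (x ∷ xs) y ys = nth-++-length xs y ys

nth-map : ∀ f xs j → j < length xs → nth (map f xs) j ≡ f (nth xs j)
nth-map f (x ∷ xs) zero    _         = refl
nth-map f (x ∷ xs) (suc j) (s≤s j<) = nth-map f xs j j<

at-++ˡ : ∀ W ys i → i ≤ length W → at (W ++ ys) i ≡ at W i
at-++ˡ []      []       zero          _       = refl
at-++ˡ []      (y ∷ ys) zero          _       = refl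
at-++ˡ (s ∷ W) ys       zero          _       = refl
at-++ˡ (s ∷ W) ys       (suc zero)    _       = refl
at-++ˡ (s ∷ W) ys       (suc (suc k)) (s≤s i≤) = at-++ˡ W ys (suc k) i≤

at-∷ʳ : ∀ W s → at (W ∷ʳ s) (suc (length W)) ≡ s
at-∷ʳ []      s = refl
at-∷ʳ (_ ∷ W) s = at-∷ʳ W s

length-∷ʳ : ∀ {A : Set} (xs : List A) x → length (xs ∷ʳ x) ≡ suc (length xs)
length-∷ʳ []       x = refl
length-∷ʳ (y ∷ xs) x = cong suc (length-∷ʳ xs x)

take-++ˡ : ∀ {A : Set} (xs ys : List A) i → i ≤ length xs → take i (xs ++ ys) ≡ take i xs
take-++ˡ xs       ys zero    _        = refl
take-++ˡ (x ∷ xs) ys (suc i) (s≤s i≤) = cong (x ∷_) (take-++ˡ xs ys i i≤)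

drop-++ˡ : ∀ {A : Set} (xs ys : List A) i → i ≤ length xs → drop i (xs ++ ys) ≡ drop i xs ++ ys
drop-++ˡ xs       ys zero    _        = refl
drop-++ˡ (x ∷ xs) ys (suc i) (s≤s i≤) = drop-++ˡ xs ys i i≤

drop-suc-length : ∀ {A : Set} (xs ys : List A) → drop (suc (length xs)) (xs ++ ys) ≡ drop 1 ys
drop-suc-length []       ys = refl
drop-suc-length (x ∷ xs) ys = drop-suc-length xs ys

#N-++ : ∀ xs ys → #N (xs ++ ys) ≡ #N xs + #N ys
#N-++ [] ys = refl
#N-++ ((N , _) ∷ xs) ys = cong suc (#N-++ xs ys)
#N-++ ((E , _) ∷ xs) ys = #N-++ xs ys
#N-++ ((D , _) ∷ xs) ys = #N-++ xs ys

#E-++ : ∀ xs ys → #E (xs ++ ys) ≡ #E xs + #E ys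
#E-++ [] ys = refl
#E-++ ((N , _) ∷ xs) ys = #E-++ xs ys
#E-++ ((E , _) ∷ xs) ys = cong suc (#E-++ xs ys)
#E-++ ((D , _) ∷ xs) ys = #E-++ xs ys

#D-++ : ∀ xs ys → #D (xs ++ ys) ≡ #D xs + #D ys
#D-++ [] ys = refl
#D-++ ((N , _) ∷ xs) ys = #D-++ xs ys
#D-++ ((E , _) ∷ xs) ys = #D-++ xs ys
#D-++ ((D , _) ∷ xs) ys = cong suc (#D-++ xs ys)

#D1-++ : ∀ xs ys → #D1 (xs ++ ys) ≡ #D1 xs + #D1 ys
#D1-++ [] ys = refl
#D1-++ ((N , _) ∷ xs) ys = #D1-++ xs ys
#D1-++ ((E , _) ∷ xs) ys = #D1-++ xs ys
#D1-++ ((D , zero) ∷ xs) ys = #D1-++ xs ys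
#D1-++ ((D , suc zero) ∷ xs) ys = cong suc (#D1-++ xs ys)
#D1-++ ((D , suc (suc _)) ∷ xs) ys = #D1-++ xs ys

WeightEquation : ℕ → List Step → ℕ → ℕ → Set
WeightEquation n W a b = label (at W b) + (2 * (a + mOf W a + dOf W b) + label (at W a)) ≡ 2 * n + 3

AtEveryStep : List Step → (ℕ → Step → Set) → Set
AtEveryStep W P = ∀ i → 1 ≤ i → i ≤ length W → P i (at W i)

DiagonalPair : ℕ → List Step → ℕ → ℕ → Set
DiagonalPair n W a b = letter (at W b) ≡ D × WeightEquation n W a b

DiagonalPairs : ℕ → List Step → (ℕ → ℕ) → ℕ → Set
DiagonalPairs n W ι t = ∀ j → 1 ≤ j → j ≤ t / 2 → label (at W (ι j)) ≢ 1 → DiagonalPair n W (ι j) (ι (t + 1 ∸ j))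

AfterMiddle : (ℕ → ℕ) → ℕ → ℕ → Step → Set
AfterMiddle ι t i s = IsD1 s → ι (t / 2) < i

LettersMirror : List Step → (ℕ → ℕ) → ℕ → Letter → Letter → Set
LettersMirror W ι t L L' = ∀ j → 1 ≤ j → j ≤ t → letter (at W (ι j)) ≡ L → letter (at W (ι (t + 1 ∸ j))) ≡ L'

-- IsWeightedDelannoy with the positions i_j and their number t turned into
-- parameters, and with condition (4) over ℕ, so that it can be transported
-- along the changes of word that build a path.
record IsWeightedDelannoyAt (n : ℕ) (W : List Step) (ι : ℕ → ℕ) (t : ℕ) : Set where
  field
    labels  : AtEveryStep W (λ _ → LabelOK)
    countNE : #N W + #D W ≡ n
    countED : #E W + #D W ≡ n
    tEven   : t % 2 ≡ 0
    d1After : AtEveryStep W (AfterMiddle ι t)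
    NtoE    : LettersMirror W ι t N E
    EtoN    : LettersMirror W ι t E N
    weights : DiagonalPairs n W ι t

IsWeightedDelannoy′ : ℕ → List Step → Set
IsWeightedDelannoy′ n W = IsWeightedDelannoyAt n W (idx W) (tOf W)

fromIsWeightedDelannoy : ∀ {n W} → IsWeightedDelannoy n W → IsWeightedDelannoy′ n W
fromIsWeightedDelannoy {n} {W} w = record
  { labels  = labels ; countNE = countNE ; countED = countED ; tEven = tEven
  ; d1After = d1After ; NtoE = NtoE ; EtoN = EtoN
  ; weights = λ j 1≤j j≤ l≢1 → let (isD , eq) = weights j 1≤j j≤ l≢1 in
      isD , +x≡A-B-l⇒x+[B+l]≡A _ _ (2 * (idx W j + mOf W (idx W j) + dOf W (idx W (tOf W + 1 ∸ j)))) _ eq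
  }
  where open IsWeightedDelannoy w

toIsWeightedDelannoy : ∀ {n W} → IsWeightedDelannoy′ n W → IsWeightedDelannoy n W
toIsWeightedDelannoy {n} {W} w = record
  { labels  = labels ; countNE = countNE ; countED = countED ; tEven = tEven
  ; d1After = d1After ; NtoE = NtoE ; EtoN = EtoN
  ; weights = λ j 1≤j j≤ l≢1 → let (isD , eq) = weights j 1≤j j≤ l≢1 in
      isD , x+[B+l]≡A⇒+x≡A-B-l _ _ (2 * (idx W j + mOf W (idx W j) + dOf W (idx W (tOf W + 1 ∸ j)))) _ eq
  }
  where open IsWeightedDelannoyAt w

IsWeightedDelannoyAt-cong : ∀ {n W ι ι' t} → ι ≗ ι' → IsWeightedDelannoyAt n W ι t → IsWeightedDelannoyAt n W ι' t
IsWeightedDelannoyAt-cong {n} {W} {ι} {ι'} {t} e w = record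
  { labels  = labels ; countNE = countNE ; countED = countED ; tEven = tEven
  ; d1After = λ i 1≤i i≤ d → subst (_< i) (e _) (d1After i 1≤i i≤ d)
  ; NtoE    = mirror NtoE
  ; EtoN    = mirror EtoN
  ; weights = λ j 1≤j j≤ l≢1 →
      subst₂ (DiagonalPair n W) (e j) (e _)
        (weights j 1≤j j≤ (subst (λ y → label (at W y) ≢ 1) (sym (e j)) l≢1))
  }
  where
  open IsWeightedDelannoyAt w
  mirror : ∀ {L L'} → LettersMirror W ι t L L' → LettersMirror W ι' t L L'
  mirror {L} {L'} m j 1≤j j≤t x = subst (λ y → letter (at W y) ≡ L') (e _)
    (m j 1≤j j≤t (subst (λ y → letter (at W y) ≡ L) (sym (e j)) x))

record PositionsIn (M : List Step) (ι : ℕ → ℕ) (t : ℕ) : Set where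
  field
    ι-zero   : ι 0 ≡ 0
    ι-bounds : ∀ j → 1 ≤ j → j ≤ t → 1 ≤ ι j × ι j ≤ length M

  ι≤length : ∀ j → j ≤ t → ι j ≤ length M
  ι≤length zero    _   rewrite ι-zero = z≤n
  ι≤length (suc j) j≤t = proj₂ (ι-bounds (suc j) (s≤s z≤n) j≤t)

idx-positionsIn : ∀ M → PositionsIn M (idx M) (tOf M)
idx-positionsIn M = record { ι-zero = refl ; ι-bounds = bounds }
  where
  bounds : ∀ j → 1 ≤ j → j ≤ tOf M → 1 ≤ idx M j × idx M j ≤ length M
  bounds (suc j) _ j<t with All-nth j (nonD1From-bounds 1 M) j<t
  ... | 1≤ , <1+length = 1≤ , ℕ.≤-pred <1+length

mirror-bounds : ∀ t j → 1 ≤ j → j ≤ t → 1 ≤ t + 1 ∸ j × t + 1 ∸ j ≤ t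
mirror-bounds t (suc j) _ j<t rewrite ℕ.+-comm t 1 = ℕ.m<n⇒0<n∸m j<t , ℕ.m∸n≤m t j

LettersMirror-cong : ∀ W W' {ι t L L'} → (∀ j → j ≤ t → at W (ι j) ≡ at W' (ι j)) →
                     LettersMirror W ι t L L' → LettersMirror W' ι t L L'
LettersMirror-cong W W' {t = t} {L} {L'} agree m j 1≤j j≤t x =
  subst (λ s → letter s ≡ L') (agree _ (proj₂ (mirror-bounds t j 1≤j j≤t)))
    (m j 1≤j j≤t (subst (λ s → letter s ≡ L) (sym (agree j j≤t)) x))

AtEveryStep-map : ∀ {W P Q} → (∀ i s → 1 ≤ i → P i s → Q i s) → AtEveryStep W P → AtEveryStep W Q
AtEveryStep-map f all i 1≤i i≤ = f i _ 1≤i (all i 1≤i i≤)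

AtEveryStep-∷ : ∀ {P W s} → P 1 s → AtEveryStep W (λ i → P (suc i)) → AtEveryStep (s ∷ W) P
AtEveryStep-∷ first rest (suc zero)    _ _          = first
AtEveryStep-∷ first rest (suc (suc i)) _ (s≤s i≤) = rest (suc i) (s≤s z≤n) i≤

AtEveryStep-∷⁻ : ∀ {P W s} → AtEveryStep (s ∷ W) P → AtEveryStep W (λ i → P (suc i))
AtEveryStep-∷⁻ all (suc i) _ i≤ = all (suc (suc i)) (s≤s z≤n) (s≤s i≤)

AtEveryStep-∷ʳ : ∀ {P W s} → AtEveryStep W P → P (suc (length W)) s → AtEveryStep (W ∷ʳ s) P
AtEveryStep-∷ʳ {P} {W} {s} all last i 1≤i i≤ with ℕ.m≤n⇒m<n∨m≡n (subst (i ≤_) (length-∷ʳ W s) i≤)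
... | inj₁ (s≤s i≤W) = subst (P i) (sym (at-++ˡ W [ s ] i i≤W)) (all i 1≤i i≤W)
... | inj₂ refl      = subst (P _) (sym (at-∷ʳ W s)) last

AtEveryStep-∷ʳ⁻ : ∀ {P W s} → AtEveryStep (W ∷ʳ s) P → AtEveryStep W P
AtEveryStep-∷ʳ⁻ {P} {W} {s} all i 1≤i i≤W =
  subst (P i) (at-++ˡ W [ s ] i i≤W) (all i 1≤i (subst (i ≤_) (sym (length-∷ʳ W s)) (ℕ.m≤n⇒m≤1+n i≤W)))

mOf-∷ʳ : ∀ M s x → x ≤ length M → mOf (M ∷ʳ s) x ≡ mOf M x
mOf-∷ʳ M s x x≤ = cong #l≠1 (take-++ˡ M [ s ] (x ∸ 1) (ℕ.≤-trans (ℕ.m∸n≤m x 1) x≤))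

dOf-∷ʳ : ∀ M s x → x ≤ length M → dOf (M ∷ʳ s) x ≡ dOf M x + #D1 [ s ]
dOf-∷ʳ M s x x≤ = trans (cong #D1 (drop-++ˡ M [ s ] x x≤)) (#D1-++ (drop x M) [ s ])

≡-shift : ∀ c {x y x' y'} → x' ≡ c + x → y' ≡ c + y → x ≡ y → x' ≡ y'
≡-shift c x'≡ y'≡ x≡y = trans x'≡ (trans (cong (c +_) x≡y) (sym y'≡))

≡-unshift : ∀ c {x y x' y'} → x' ≡ c + x → y' ≡ c + y → x' ≡ y' → x ≡ y
≡-unshift c x'≡ y'≡ x'≡y' = ℕ.+-cancelˡ-≡ c _ _ (trans (sym x'≡) (trans x'≡y' y'≡))

half-suc-suc : ∀ t → suc (suc t) / 2 ≡ suc (t / 2)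
half-suc-suc t = m/n≡1+[m∸n]/n {suc (suc t)} {2} (s≤s (s≤s z≤n))

mod2-suc-suc : ∀ t → suc (suc t) % 2 ≡ t % 2
mod2-suc-suc t = trans (cong (_% 2) (ℕ.+-comm 2 t)) ([m+n]%n≡m%n t 2)

mirror-suc : ∀ t y → y ≤ t → suc (suc t) + 1 ∸ suc y ≡ suc (t + 1 ∸ y)
mirror-suc t y y≤t = ℕ.+-∸-assoc 1 (ℕ.≤-trans y≤t (ℕ.m≤m+n t 1))

module SnocD1 (M : List Step) where

  at-snoc : ∀ x → x ≤ length M → at (M ∷ʳ D1) x ≡ at M x
  at-snoc x = at-++ˡ M [ D1 ] x

  #N+#D-snoc : #N (M ∷ʳ D1) + #D (M ∷ʳ D1) ≡ suc (#N M + #D M)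
  #N+#D-snoc rewrite #N-++ M [ D1 ] | #D-++ M [ D1 ] = solve (#N M) (#D M)
    where solve : ∀ a b → a + 0 + (b + 1) ≡ suc (a + b)
          solve = solve-∀

  #E+#D-snoc : #E (M ∷ʳ D1) + #D (M ∷ʳ D1) ≡ suc (#E M + #D M)
  #E+#D-snoc rewrite #E-++ M [ D1 ] | #D-++ M [ D1 ] = solve (#E M) (#D M)
    where solve : ∀ a b → a + 0 + (b + 1) ≡ suc (a + b)
          solve = solve-∀

  module _ {n a b : ℕ} (a≤ : a ≤ length M) (b≤ : b ≤ length M) where

    private
      lhs : label (at (M ∷ʳ D1) b) + (2 * (a + mOf (M ∷ʳ D1) a + dOf (M ∷ʳ D1) b) + label (at (M ∷ʳ D1) a))
            ≡ 2 + (label (at M b) + (2 * (a + mOf M a + dOf M b) + label (at M a)))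
      lhs rewrite at-snoc a a≤ | at-snoc b b≤ | mOf-∷ʳ M D1 a a≤ | dOf-∷ʳ M D1 b b≤ =
        solve (label (at M b)) a (mOf M a) (dOf M b) (label (at M a))
        where solve : ∀ lb a m d la → lb + (2 * (a + m + (d + 1)) + la) ≡ 2 + (lb + (2 * (a + m + d) + la))
              solve = solve-∀

      rhs : 2 * suc n + 3 ≡ 2 + (2 * n + 3)
      rhs = solve n
        where solve : ∀ n → 2 * suc n + 3 ≡ 2 + (2 * n + 3)
              solve = solve-∀

    weightEquation-snoc : WeightEquation n M a b → WeightEquation (suc n) (M ∷ʳ D1) a b
    weightEquation-snoc = ≡-shift 2 lhs rhs

    weightEquation-snoc⁻ : WeightEquation (suc n) (M ∷ʳ D1) a b → WeightEquation n M a b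
    weightEquation-snoc⁻ = ≡-unshift 2 lhs rhs

  module _ {n : ℕ} {ι : ℕ → ℕ} {t : ℕ} (B : PositionsIn M ι t) where
    open PositionsIn B

    private
      agree : ∀ j → j ≤ t → at M (ι j) ≡ at (M ∷ʳ D1) (ι j)
      agree j j≤t = sym (at-snoc (ι j) (ι≤length j j≤t))

      mirror≤ : ∀ j → 1 ≤ j → j ≤ t → ι (t + 1 ∸ j) ≤ length M
      mirror≤ j 1≤j j≤t = ι≤length _ (proj₂ (mirror-bounds t j 1≤j j≤t))

      half≤t : ∀ {j} → j ≤ t / 2 → j ≤ t
      half≤t j≤ = ℕ.≤-trans j≤ (m/n≤m t 2)

    preserves : IsWeightedDelannoyAt n M ι t → IsWeightedDelannoyAt (suc n) (M ∷ʳ D1) ι t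
    preserves w = record
      { labels  = AtEveryStep-∷ʳ {λ _ → LabelOK} {M} labels (s≤s z≤n)
      ; countNE = trans #N+#D-snoc (cong suc countNE)
      ; countED = trans #E+#D-snoc (cong suc countED)
      ; tEven   = tEven
      ; d1After = AtEveryStep-∷ʳ {AfterMiddle ι t} {M} d1After (λ _ → s≤s (ι≤length (t / 2) (m/n≤m t 2)))
      ; NtoE    = LettersMirror-cong M (M ∷ʳ D1) agree NtoE
      ; EtoN    = LettersMirror-cong M (M ∷ʳ D1) agree EtoN
      ; weights = λ j 1≤j j≤ l≢1 →
          let (isD , eq) = weights j 1≤j j≤ (subst (λ s → label s ≢ 1) (sym (agree j (half≤t j≤))) l≢1)
          in subst (λ s → letter s ≡ D) (agree _ (proj₂ (mirror-bounds t j 1≤j (half≤t j≤)))) isD ,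
             weightEquation-snoc (ι≤length j (half≤t j≤)) (mirror≤ j 1≤j (half≤t j≤)) eq
      }
      where open IsWeightedDelannoyAt w

    reflects : IsWeightedDelannoyAt (suc n) (M ∷ʳ D1) ι t → IsWeightedDelannoyAt n M ι t
    reflects w = record
      { labels  = AtEveryStep-∷ʳ⁻ {λ _ → LabelOK} {M} labels
      ; countNE = ℕ.suc-injective (trans (sym #N+#D-snoc) countNE)
      ; countED = ℕ.suc-injective (trans (sym #E+#D-snoc) countED)
      ; tEven   = tEven
      ; d1After = AtEveryStep-∷ʳ⁻ {AfterMiddle ι t} {M} d1After
      ; NtoE    = LettersMirror-cong (M ∷ʳ D1) M (λ j → sym ∘ agree j) NtoE
      ; EtoN    = LettersMirror-cong (M ∷ʳ D1) M (λ j → sym ∘ agree j) EtoN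
      ; weights = λ j 1≤j j≤ l≢1 →
          let (isD , eq) = weights j 1≤j j≤ (subst (λ s → label s ≢ 1) (agree j (half≤t j≤)) l≢1)
          in subst (λ s → letter s ≡ D) (sym (agree _ (proj₂ (mirror-bounds t j 1≤j (half≤t j≤))))) isD ,
             weightEquation-snoc⁻ (ι≤length j (half≤t j≤)) (mirror≤ j 1≤j (half≤t j≤)) eq
      }
      where open IsWeightedDelannoyAt w

-- In pairDD, a + b = 2n + 1 is condition (4) for the outer pair.
data WrapPair (n : ℕ) : Step → Step → ℕ → Set where
  pairNE : WrapPair n (N , 1) (E , 1) (suc n)
  pairEN : WrapPair n (E , 1) (N , 1) (suc n)
  pairDD : ∀ a b → a + b ≡ 2 * n + 1 → WrapPair n (D , suc (suc a)) (D , suc (suc b)) (suc (suc n))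

module _ {n : ℕ} {f g : Step} {n' : ℕ} where

  heavy : WrapPair n f g n' → ℕ
  heavy pairNE         = 0
  heavy pairEN         = 0
  heavy (pairDD _ _ _) = 1

  wrap-size : (wr : WrapPair n f g n') → n' ≡ suc (heavy wr + n)
  wrap-size pairNE         = refl
  wrap-size pairEN         = refl
  wrap-size (pairDD _ _ _) = refl

  first-¬D1 : WrapPair n f g n' → ¬ IsD1 f
  first-¬D1 pairNE         = λ ()
  first-¬D1 pairEN         = λ ()
  first-¬D1 (pairDD _ _ _) = λ ()

  last-¬D1 : WrapPair n f g n' → ¬ IsD1 g
  last-¬D1 pairNE         = λ ()
  last-¬D1 pairEN         = λ ()
  last-¬D1 (pairDD _ _ _) = λ ()

  first-labelOK : WrapPair n f g n' → LabelOK f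
  first-labelOK pairNE         = refl
  first-labelOK pairEN         = refl
  first-labelOK (pairDD _ _ _) = s≤s z≤n

  last-labelOK : WrapPair n f g n' → LabelOK g
  last-labelOK pairNE         = refl
  last-labelOK pairEN         = refl
  last-labelOK (pairDD _ _ _) = s≤s z≤n

  #l≠1-first : (wr : WrapPair n f g n') → ∀ W → #l≠1 (f ∷ W) ≡ heavy wr + #l≠1 W
  #l≠1-first pairNE         W = refl
  #l≠1-first pairEN         W = refl
  #l≠1-first (pairDD _ _ _) W = refl

  #D1-last : WrapPair n f g n' → #D1 [ g ] ≡ 0
  #D1-last pairNE         = refl
  #D1-last pairEN         = refl
  #D1-last (pairDD _ _ _) = refl

  #N+#D-wrap : (wr : WrapPair n f g n') → ∀ M → #N (f ∷ M ++ [ g ]) + #D (f ∷ M ++ [ g ]) ≡ suc (heavy wr) + (#N M + #D M)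
  #N+#D-wrap pairNE M rewrite #N-++ M [ (E , 1) ] | #D-++ M [ (E , 1) ] = solve (#N M) (#D M)
    where solve : ∀ a b → suc (a + 0) + (b + 0) ≡ suc (a + b)
          solve = solve-∀
  #N+#D-wrap pairEN M rewrite #N-++ M [ (N , 1) ] | #D-++ M [ (N , 1) ] = solve (#N M) (#D M)
    where solve : ∀ a b → a + 1 + (b + 0) ≡ suc (a + b)
          solve = solve-∀
  #N+#D-wrap (pairDD a b _) M rewrite #N-++ M [ g ] | #D-++ M [ g ] = solve (#N M) (#D M)
    where solve : ∀ a b → a + 0 + suc (b + 1) ≡ suc (suc (a + b))
          solve = solve-∀

  #E+#D-wrap : (wr : WrapPair n f g n') → ∀ M → #E (f ∷ M ++ [ g ]) + #D (f ∷ M ++ [ g ]) ≡ suc (heavy wr) + (#E M + #D M)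
  #E+#D-wrap pairNE M rewrite #E-++ M [ (E , 1) ] | #D-++ M [ (E , 1) ] = solve (#E M) (#D M)
    where solve : ∀ a b → a + 1 + (b + 0) ≡ suc (a + b)
          solve = solve-∀
  #E+#D-wrap pairEN M rewrite #E-++ M [ (N , 1) ] | #D-++ M [ (N , 1) ] = solve (#E M) (#D M)
    where solve : ∀ a b → suc (a + 0) + (b + 0) ≡ suc (a + b)
          solve = solve-∀
  #E+#D-wrap (pairDD a b _) M rewrite #E-++ M [ g ] | #D-++ M [ g ] = solve (#E M) (#D M)
    where solve : ∀ a b → a + 0 + suc (b + 1) ≡ suc (suc (a + b))
          solve = solve-∀

data Opposite : Letter → Letter → Set where
  N↔E : Opposite N E
  E↔N : Opposite E N

module _ {n : ℕ} {f g : Step} {n' : ℕ} {L L' : Letter} where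

  wrap-first→last : WrapPair n f g n' → Opposite L L' → letter f ≡ L → letter g ≡ L'
  wrap-first→last pairNE         N↔E _ = refl
  wrap-first→last pairEN         E↔N _ = refl
  wrap-first→last pairNE         E↔N ()
  wrap-first→last pairEN         N↔E ()
  wrap-first→last (pairDD _ _ _) N↔E ()
  wrap-first→last (pairDD _ _ _) E↔N ()

  wrap-last→first : WrapPair n f g n' → Opposite L L' → letter g ≡ L → letter f ≡ L'
  wrap-last→first pairNE         E↔N _ = refl
  wrap-last→first pairEN         N↔E _ = refl
  wrap-last→first pairNE         N↔E ()
  wrap-last→first pairEN         E↔N ()
  wrap-last→first (pairDD _ _ _) N↔E ()
  wrap-last→first (pairDD _ _ _) E↔N ()

-- ι' lists the positions in f ∷ M ++ [ g ] of the steps other than (D,1),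
-- given those (ι) in M.
record WrappedPositions (M : List Step) (ι ι' : ℕ → ℕ) (t : ℕ) : Set where
  field
    ι'-first  : ι' 1 ≡ 1
    ι'-middle : ∀ p → 1 ≤ p → p ≤ t → ι' (suc p) ≡ suc (ι p)
    ι'-last   : ι' (suc (suc t)) ≡ suc (suc (length M))

module Wrapped (M : List Step) {n f g n'} (wr : WrapPair n f g n') where

  at-middle : ∀ x → 1 ≤ x → x ≤ length M → at (f ∷ M ++ [ g ]) (suc x) ≡ at M x
  at-middle (suc x) _ = at-++ˡ M [ g ] (suc x)

  mOf-middle : ∀ x → 1 ≤ x → x ≤ length M → mOf (f ∷ M ++ [ g ]) (suc x) ≡ heavy wr + mOf M x
  mOf-middle (suc x) _ x< = trans (#l≠1-first wr (take x (M ++ [ g ])))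
    (cong (λ z → heavy wr + #l≠1 z) (take-++ˡ M [ g ] x (ℕ.≤-trans (ℕ.n≤1+n x) x<)))

  dOf-middle : ∀ x → x ≤ length M → dOf (f ∷ M ++ [ g ]) (suc x) ≡ dOf M x
  dOf-middle x x≤ = trans (dOf-∷ʳ M g x x≤) (trans (cong (dOf M x +_) (#D1-last wr)) (ℕ.+-identityʳ _))

  module _ {a b} (1≤a : 1 ≤ a) (a≤ : a ≤ length M) (1≤b : 1 ≤ b) (b≤ : b ≤ length M) where

    private
      c = 2 * suc (heavy wr)

      lhs : label (at (f ∷ M ++ [ g ]) (suc b))
              + (2 * (suc a + mOf (f ∷ M ++ [ g ]) (suc a) + dOf (f ∷ M ++ [ g ]) (suc b)) + label (at (f ∷ M ++ [ g ]) (suc a)))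
            ≡ c + (label (at M b) + (2 * (a + mOf M a + dOf M b) + label (at M a)))
      lhs rewrite at-middle a 1≤a a≤ | at-middle b 1≤b b≤ | mOf-middle a 1≤a a≤ | dOf-middle b b≤ =
        solve (label (at M b)) a (heavy wr) (mOf M a) (dOf M b) (label (at M a))
        where solve : ∀ lb a h m d la → lb + (2 * (suc a + (h + m) + d) + la) ≡ 2 * suc h + (lb + (2 * (a + m + d) + la))
              solve = solve-∀

      rhs : 2 * n' + 3 ≡ c + (2 * n + 3)
      rhs = trans (cong (λ k → 2 * k + 3) (wrap-size wr)) (solve (heavy wr) n)
        where solve : ∀ h n → 2 * suc (h + n) + 3 ≡ 2 * suc h + (2 * n + 3)
              solve = solve-∀

    weightEquation-wrap : WeightEquation n M a b → WeightEquation n' (f ∷ M ++ [ g ]) (suc a) (suc b)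
    weightEquation-wrap = ≡-shift c lhs rhs

    weightEquation-unwrap : WeightEquation n' (f ∷ M ++ [ g ]) (suc a) (suc b) → WeightEquation n M a b
    weightEquation-unwrap = ≡-unshift c lhs rhs

weightEquation-outer : ∀ M {n f g n'} → WrapPair n f g n' → label f ≢ 1 →
                       letter g ≡ D × WeightEquation n' (f ∷ M ++ [ g ]) 1 (suc (suc (length M)))
weightEquation-outer M pairNE l≢1 = ⊥-elim (l≢1 refl)
weightEquation-outer M pairEN l≢1 = ⊥-elim (l≢1 refl)
weightEquation-outer M {n} {g = g} (pairDD a b a+b≡) _ rewrite at-∷ʳ M g | drop-suc-length M [ g ] =
  refl , trans (solve a b) (trans (cong (6 +_) a+b≡) (solve′ n))
  where solve : ∀ a b → suc (suc b) + (2 * (1 + 0 + 0) + suc (suc a)) ≡ 6 + (a + b)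
        solve = solve-∀
        solve′ : ∀ n → 6 + (2 * n + 1) ≡ 2 * suc (suc n) + 3
        solve′ = solve-∀

module _ {t : ℕ} where

  data WrapIndex : ℕ → Set where
    firstIndex  : WrapIndex 1
    middleIndex : ∀ y → 1 ≤ y → y ≤ t → WrapIndex (suc y)
    lastIndex   : WrapIndex (suc (suc t))

  wrapIndex : ∀ j → 1 ≤ j → j ≤ suc (suc t) → WrapIndex j
  wrapIndex (suc zero)    _ _        = firstIndex
  wrapIndex (suc (suc y)) _ (s≤s j≤) with ℕ.m≤n⇒m<n∨m≡n j≤
  ... | inj₁ (s≤s y<t) = middleIndex (suc y) (s≤s z≤n) y<t
  ... | inj₂ refl      = lastIndex

module WrapTransport (M : List Step) {n f g n'} (wr : WrapPair n f g n') {ι ι' t}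
                     (B : PositionsIn M ι t) (P : WrappedPositions M ι ι' t) where

  open Wrapped M wr
  open PositionsIn B
  open WrappedPositions P

  private
    W' : List Step
    W' = f ∷ M ++ [ g ]

    T : ℕ
    T = suc (suc t)

    at-ι' : ∀ p → 1 ≤ p → p ≤ t → at W' (ι' (suc p)) ≡ at M (ι p)
    at-ι' p 1≤p p≤t = trans (cong (at W') (ι'-middle p 1≤p p≤t))
      (at-middle (ι p) (proj₁ (ι-bounds p 1≤p p≤t)) (proj₂ (ι-bounds p 1≤p p≤t)))

    ι'-mirror-first : ι' (T + 1 ∸ 1) ≡ suc (suc (length M))
    ι'-mirror-first = trans (cong ι' (ℕ.m+n∸n≡m T 1)) ι'-last

    ι'-mirror-last : ι' (T + 1 ∸ T) ≡ 1
    ι'-mirror-last = trans (cong ι' (ℕ.m+n∸m≡n T 1)) ι'-first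

    ι'-mirror-middle : ∀ y → 1 ≤ y → y ≤ t → ι' (T + 1 ∸ suc y) ≡ suc (ι (t + 1 ∸ y))
    ι'-mirror-middle y 1≤y y≤t = trans (cong ι' (mirror-suc t y y≤t)) (ι'-middle _ 1≤m m≤t)
      where open Σ (mirror-bounds t y 1≤y y≤t) renaming (proj₁ to 1≤m; proj₂ to m≤t)

    at-mirror : ∀ y → 1 ≤ y → y ≤ t → at W' (ι' (T + 1 ∸ suc y)) ≡ at M (ι (t + 1 ∸ y))
    at-mirror y 1≤y y≤t = trans (cong (at W' ∘ ι') (mirror-suc t y y≤t)) (at-ι' _ 1≤m m≤t)
      where open Σ (mirror-bounds t y 1≤y y≤t) renaming (proj₁ to 1≤m; proj₂ to m≤t)

  d1Bound-wrap : ∀ h x → h ≤ t → 1 ≤ x → ι h < x → ι' (suc h) < suc x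
  d1Bound-wrap zero    x _   1≤x _   rewrite ι'-first = s≤s 1≤x
  d1Bound-wrap (suc h) x h≤t _   ι<x rewrite ι'-middle (suc h) (s≤s z≤n) h≤t = s≤s ι<x

  d1Bound-unwrap : ∀ h x → h ≤ t → 1 ≤ x → ι' (suc h) < suc x → ι h < x
  d1Bound-unwrap zero    x _   1≤x _    rewrite ι-zero = 1≤x
  d1Bound-unwrap (suc h) x h≤t _   ι'<x rewrite ι'-middle (suc h) (s≤s z≤n) h≤t = ℕ.≤-pred ι'<x

  LettersMirror-wrap : ∀ {L L'} → Opposite L L' → LettersMirror M ι t L L' → LettersMirror W' ι' T L L'
  LettersMirror-wrap {L} {L'} opp m j 1≤j j≤T x with wrapIndex j 1≤j j≤T
  ... | firstIndex = subst (λ z → letter (at W' z) ≡ L') (sym ι'-mirror-first)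
          (subst (λ s → letter s ≡ L') (sym (at-∷ʳ M g))
            (wrap-first→last wr opp (subst (λ z → letter (at W' z) ≡ L) ι'-first x)))
  ... | middleIndex y 1≤y y≤t = subst (λ s → letter s ≡ L') (sym (at-mirror y 1≤y y≤t))
          (m y 1≤y y≤t (subst (λ s → letter s ≡ L) (at-ι' y 1≤y y≤t) x))
  ... | lastIndex = subst (λ z → letter (at W' z) ≡ L') (sym ι'-mirror-last)
          (wrap-last→first wr opp (subst (λ s → letter s ≡ L) (at-∷ʳ M g) (subst (λ z → letter (at W' z) ≡ L) ι'-last x)))

  LettersMirror-unwrap : ∀ {L L'} → LettersMirror W' ι' T L L' → LettersMirror M ι t L L'
  LettersMirror-unwrap {L} {L'} m j 1≤j j≤t x =
    subst (λ s → letter s ≡ L') (at-mirror j 1≤j j≤t)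
      (m (suc j) (s≤s z≤n) (s≤s (ℕ.m≤n⇒m≤1+n j≤t)) (subst (λ s → letter s ≡ L) (sym (at-ι' j 1≤j j≤t)) x))

  private
    half-pred : ∀ {y} → suc y ≤ T / 2 → y ≤ t / 2
    half-pred {y} y< = ℕ.≤-pred (subst (suc y ≤_) (half-suc-suc t) y<)

    half-suc : ∀ {y} → y ≤ t / 2 → suc y ≤ T / 2
    half-suc {y} y≤ = subst (suc y ≤_) (sym (half-suc-suc t)) (s≤s y≤)

    half≤t : ∀ {y} → y ≤ t / 2 → y ≤ t
    half≤t y≤ = ℕ.≤-trans y≤ (m/n≤m t 2)

    diagonalPair-wrap : ∀ y → 1 ≤ y → y ≤ t → DiagonalPair n M (ι y) (ι (t + 1 ∸ y)) →
                        DiagonalPair n' W' (ι' (suc y)) (ι' (T + 1 ∸ suc y))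
    diagonalPair-wrap y 1≤y y≤t (isD , eq) =
      subst₂ (DiagonalPair n' W') (sym (ι'-middle y 1≤y y≤t)) (sym (ι'-mirror-middle y 1≤y y≤t))
        (subst (λ s → letter s ≡ D) (sym (at-middle _ (proj₁ bm) (proj₂ bm))) isD ,
         weightEquation-wrap (proj₁ by) (proj₂ by) (proj₁ bm) (proj₂ bm) eq)
      where
      by = ι-bounds y 1≤y y≤t
      bm = ι-bounds _ (proj₁ (mirror-bounds t y 1≤y y≤t)) (proj₂ (mirror-bounds t y 1≤y y≤t))

    diagonalPair-unwrap : ∀ y → 1 ≤ y → y ≤ t → DiagonalPair n' W' (ι' (suc y)) (ι' (T + 1 ∸ suc y)) →
                          DiagonalPair n M (ι y) (ι (t + 1 ∸ y))
    diagonalPair-unwrap y 1≤y y≤t d with subst₂ (DiagonalPair n' W') (ι'-middle y 1≤y y≤t) (ι'-mirror-middle y 1≤y y≤t) d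
    ... | isD , eq =
      subst (λ s → letter s ≡ D) (at-middle _ (proj₁ bm) (proj₂ bm)) isD ,
      weightEquation-unwrap (proj₁ by) (proj₂ by) (proj₁ bm) (proj₂ bm) eq
      where
      by = ι-bounds y 1≤y y≤t
      bm = ι-bounds _ (proj₁ (mirror-bounds t y 1≤y y≤t)) (proj₂ (mirror-bounds t y 1≤y y≤t))

  weights-wrap : DiagonalPairs n M ι t → DiagonalPairs n' W' ι' T
  weights-wrap _ (suc zero) _ _ l≢1 =
    let (isD , eq) = weightEquation-outer M wr (subst (λ z → label (at W' z) ≢ 1) ι'-first l≢1) in
    subst₂ (DiagonalPair n' W') (sym ι'-first) (sym ι'-mirror-first) (subst (λ s → letter s ≡ D) (sym (at-∷ʳ M g)) isD , eq)
  weights-wrap ws (suc (suc y)) _ y< l≢1 =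
    diagonalPair-wrap (suc y) (s≤s z≤n) (half≤t (half-pred y<))
      (ws (suc y) (s≤s z≤n) (half-pred y<) (subst (λ s → label s ≢ 1) (at-ι' (suc y) (s≤s z≤n) (half≤t (half-pred y<))) l≢1))

  weights-unwrap : DiagonalPairs n' W' ι' T → DiagonalPairs n M ι t
  weights-unwrap ws j 1≤j j≤ l≢1 =
    diagonalPair-unwrap j 1≤j (half≤t j≤)
      (ws (suc j) (s≤s z≤n) (half-suc j≤) (subst (λ s → label s ≢ 1) (sym (at-ι' j 1≤j (half≤t j≤))) l≢1))

  preserves : IsWeightedDelannoyAt n M ι t → IsWeightedDelannoyAt n' W' ι' T
  preserves w = record
    { labels  = AtEveryStep-∷ {λ _ → LabelOK} (first-labelOK wr)
                  (AtEveryStep-∷ʳ {λ _ → LabelOK} {M} labels (last-labelOK wr))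
    ; countNE = trans (#N+#D-wrap wr M) (trans (cong (suc (heavy wr) +_) countNE) (sym (wrap-size wr)))
    ; countED = trans (#E+#D-wrap wr M) (trans (cong (suc (heavy wr) +_) countED) (sym (wrap-size wr)))
    ; tEven   = trans (mod2-suc-suc t) tEven
    ; d1After = AtEveryStep-∷ {AfterMiddle ι' T} (⊥-elim ∘ first-¬D1 wr)
                  (AtEveryStep-∷ʳ {AfterMiddle ι' T ∘ suc} {M} (AtEveryStep-map {M} shiftAfter d1After) (⊥-elim ∘ last-¬D1 wr))
    ; NtoE    = LettersMirror-wrap N↔E NtoE
    ; EtoN    = LettersMirror-wrap E↔N EtoN
    ; weights = weights-wrap weights
    }
    where
    open IsWeightedDelannoyAt w
    shiftAfter : ∀ i s → 1 ≤ i → AfterMiddle ι t i s → AfterMiddle ι' T (suc i) s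
    shiftAfter i s 1≤i after d = subst (λ z → ι' z < suc i) (sym (half-suc-suc t))
      (d1Bound-wrap (t / 2) i (m/n≤m t 2) 1≤i (after d))

  reflects : IsWeightedDelannoyAt n' W' ι' T → IsWeightedDelannoyAt n M ι t
  reflects w = record
    { labels  = AtEveryStep-∷ʳ⁻ {λ _ → LabelOK} {M} (AtEveryStep-∷⁻ {λ _ → LabelOK} labels)
    ; countNE = ℕ.+-cancelˡ-≡ (suc (heavy wr)) _ _ (trans (sym (#N+#D-wrap wr M)) (trans countNE (wrap-size wr)))
    ; countED = ℕ.+-cancelˡ-≡ (suc (heavy wr)) _ _ (trans (sym (#E+#D-wrap wr M)) (trans countED (wrap-size wr)))
    ; tEven   = trans (sym (mod2-suc-suc t)) tEven
    ; d1After = AtEveryStep-map {M} unshiftAfter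
                  (AtEveryStep-∷ʳ⁻ {AfterMiddle ι' T ∘ suc} {M} (AtEveryStep-∷⁻ {AfterMiddle ι' T} d1After))
    ; NtoE    = LettersMirror-unwrap NtoE
    ; EtoN    = LettersMirror-unwrap EtoN
    ; weights = weights-unwrap weights
    }
    where
    open IsWeightedDelannoyAt w
    unshiftAfter : ∀ i s → 1 ≤ i → AfterMiddle ι' T (suc i) s → AfterMiddle ι t i s
    unshiftAfter i s 1≤i after d = d1Bound-unwrap (t / 2) i (m/n≤m t 2) 1≤i
      (subst (λ z → ι' z < suc i) (half-suc-suc t) (after d))

nonD1Pos-snocD1 : ∀ M → nonD1Pos (M ∷ʳ D1) ≡ nonD1Pos M
nonD1Pos-snocD1 M = trans (nonD1From-++ 1 M [ D1 ]) (List.++-identityʳ (nonD1Pos M))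

idx-snocD1 : ∀ M → idx (M ∷ʳ D1) ≗ idx M
idx-snocD1 M zero    = refl
idx-snocD1 M (suc j) = cong (λ ps → nth ps j) (nonD1Pos-snocD1 M)

tOf-snocD1 : ∀ M → tOf (M ∷ʳ D1) ≡ tOf M
tOf-snocD1 M = cong length (nonD1Pos-snocD1 M)

module _ (M : List Step) {f g : Step} (¬f : ¬ IsD1 f) (¬g : ¬ IsD1 g) where

  private
    W' : List Step
    W' = f ∷ M ++ [ g ]

  nonD1Pos-wrap : nonD1Pos W' ≡ 1 ∷ (map suc (nonD1Pos M) ++ [ suc (suc (length M)) ])
  nonD1Pos-wrap = trans (nonD1From-∷ 1 (M ++ [ g ]) ¬f)
    (cong (1 ∷_) (trans (nonD1From-++ 2 M [ g ]) (cong₂ _++_ (nonD1From-suc 1 M) (nonD1From-single (2 + length M) ¬g))))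

  tOf-wrap : tOf W' ≡ suc (suc (tOf M))
  tOf-wrap = trans (cong length nonD1Pos-wrap)
    (cong suc (trans (length-∷ʳ (map suc (nonD1Pos M)) _) (cong suc (List.length-map suc (nonD1Pos M)))))

  idx-wrap : WrappedPositions M (idx M) (idx W') (tOf M)
  idx-wrap = record
    { ι'-first  = cong (λ ps → nth ps 0) nonD1Pos-wrap
    ; ι'-middle = λ { (suc p) _ p<t → trans (cong (λ ps → nth ps (suc p)) nonD1Pos-wrap)
        (trans (nth-++ˡ (map suc (nonD1Pos M)) _ p (subst (p <_) (sym (List.length-map suc (nonD1Pos M))) p<t))
               (nth-map suc (nonD1Pos M) p p<t)) }
    ; ι'-last   = trans (cong (λ ps → nth ps (suc (tOf M))) nonD1Pos-wrap)
        (subst (λ k → nth (map suc (nonD1Pos M) ++ [ suc (suc (length M)) ]) k ≡ suc (suc (length M)))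
          (List.length-map suc (nonD1Pos M)) (nth-++-length (map suc (nonD1Pos M)) _ []))
    }

  wrap-preserves : ∀ {n n'} → WrapPair n f g n' → IsWeightedDelannoy′ n M → IsWeightedDelannoy′ n' W'
  wrap-preserves wr w = subst (IsWeightedDelannoyAt _ W' (idx W')) (sym tOf-wrap)
    (WrapTransport.preserves M wr (idx-positionsIn M) idx-wrap w)

  wrap-reflects : ∀ {n n'} → WrapPair n f g n' → IsWeightedDelannoy′ n' W' → IsWeightedDelannoy′ n M
  wrap-reflects wr w = WrapTransport.reflects M wr (idx-positionsIn M) idx-wrap
    (subst (IsWeightedDelannoyAt _ W' (idx W')) tOf-wrap w)

snocD1-preserves : ∀ {n} M → IsWeightedDelannoy′ n M → IsWeightedDelannoy′ (suc n) (M ∷ʳ D1)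
snocD1-preserves M w = subst (IsWeightedDelannoyAt _ (M ∷ʳ D1) (idx (M ∷ʳ D1))) (sym (tOf-snocD1 M))
  (IsWeightedDelannoyAt-cong (sym ∘ idx-snocD1 M) (SnocD1.preserves M (idx-positionsIn M) w))

snocD1-reflects : ∀ {n} M → IsWeightedDelannoy′ (suc n) (M ∷ʳ D1) → IsWeightedDelannoy′ n M
snocD1-reflects M w = SnocD1.reflects M (idx-positionsIn M)
  (IsWeightedDelannoyAt-cong (idx-snocD1 M) (subst (IsWeightedDelannoyAt _ (M ∷ʳ D1) (idx (M ∷ʳ D1))) (tOf-snocD1 M) w))

bit : Bool → ℕ
bit false = 0
bit true  = 1

pairIndex : ∀ {n} → Bool → Fin (suc n) → ℕ
pairIndex b k = bit b + 2 * toℕ k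

pairIndex≤ : ∀ {n} b (k : Fin (suc n)) → pairIndex b k ≤ 2 * n + 1
pairIndex≤ {n} b k = subst (pairIndex b k ≤_) (ℕ.+-comm 1 (2 * n))
  (ℕ.+-mono-≤ (bit≤1 b) (ℕ.*-monoʳ-≤ 2 (ℕ.≤-pred (toℕ<n k))))
  where
  bit≤1 : ∀ b → bit b ≤ 1
  bit≤1 false = z≤n
  bit≤1 true  = s≤s z≤n

pairIndex-injective : ∀ {n} b b' (k k' : Fin (suc n)) → pairIndex b k ≡ pairIndex b' k' → b ≡ b' × k ≡ k'
pairIndex-injective false false k k' e = refl , toℕ-injective (ℕ.*-cancelˡ-≡ (toℕ k) (toℕ k') 2 e)
pairIndex-injective true  true  k k' e = refl , toℕ-injective (ℕ.*-cancelˡ-≡ (toℕ k) (toℕ k') 2 (ℕ.suc-injective e))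
pairIndex-injective false true  k k' e = ⊥-elim (ℕ.even≢odd (toℕ k) (toℕ k') e)
pairIndex-injective true  false k k' e = ⊥-elim (ℕ.even≢odd (toℕ k') (toℕ k) (sym e))

bit+2*-surjective : ∀ a → Σ Bool λ b → Σ ℕ λ q → bit b + 2 * q ≡ a
bit+2*-surjective zero          = false , 0 , refl
bit+2*-surjective (suc zero)    = true , 0 , refl
bit+2*-surjective (suc (suc a)) with bit+2*-surjective a
... | b , q , e = b , suc q , trans (solve (bit b) q) (cong (2 +_) e)
  where solve : ∀ x q → x + 2 * suc q ≡ 2 + (x + 2 * q)
        solve = solve-∀

pairIndex-surjective : ∀ {n} a → a ≤ 2 * n + 1 → Σ Bool λ b → Σ (Fin (suc n)) λ k → pairIndex b k ≡ a
pairIndex-surjective {n} a a≤ with bit+2*-surjective a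
... | b , q , e = b , fromℕ< (s≤s q≤n) , trans (cong (λ z → bit b + 2 * z) (toℕ-fromℕ< (s≤s q≤n))) e
  where
  2q≤ : 2 * q ≤ 2 * n + 1
  2q≤ = ℕ.≤-trans (ℕ.m≤n+m (2 * q) (bit b)) (subst (_≤ 2 * n + 1) (sym e) a≤)
  q≤n : q ≤ n
  q≤n = ℕ.≮⇒≥ λ n<q → ℕ.<-irrefl refl
    (ℕ.≤-trans (ℕ.≤-trans (ℕ.≤-reflexive (solve n)) (ℕ.*-monoʳ-≤ 2 n<q)) 2q≤)
    where solve : ∀ n → suc (2 * n + 1) ≡ 2 * suc n
          solve = solve-∀

diagonalWrapPair : ∀ {n} b (k : Fin (suc n)) →
                   WrapPair n (D , suc (suc (pairIndex b k))) (D , suc (suc (2 * n + 1 ∸ pairIndex b k))) (suc (suc n))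
diagonalWrapPair b k = pairDD _ _ (ℕ.m+[n∸m]≡n (pairIndex≤ b k))

toPath : ∀ {n} → Skeleton n → List Step
toPath nil                            = []
toPath (snocD1 t)                     = toPath t ∷ʳ D1
toPath (wrapNE t)                     = (N , 1) ∷ toPath t ++ [ (E , 1) ]
toPath (wrapEN t)                     = (E , 1) ∷ toPath t ++ [ (N , 1) ]
toPath {suc (suc n)} (wrapDD b k t)   =
  (D , suc (suc (pairIndex b k))) ∷ toPath t ++ [ (D , suc (suc (2 * n + 1 ∸ pairIndex b k))) ]

toPath-weighted : ∀ {n} (t : Skeleton n) → IsWeightedDelannoy′ n (toPath t)
toPath-weighted nil = record
  { labels = λ { _ (s≤s _) () } ; countNE = refl ; countED = refl ; tEven = refl ; d1After = λ { _ (s≤s _) () }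
  ; NtoE = λ { _ (s≤s _) () } ; EtoN = λ { _ (s≤s _) () } ; weights = λ { _ (s≤s _) () } }
toPath-weighted (snocD1 t)     = snocD1-preserves (toPath t) (toPath-weighted t)
toPath-weighted (wrapNE t)     = wrap-preserves (toPath t) (λ ()) (λ ()) pairNE (toPath-weighted t)
toPath-weighted (wrapEN t)     = wrap-preserves (toPath t) (λ ()) (λ ()) pairEN (toPath-weighted t)
toPath-weighted (wrapDD b k t) = wrap-preserves (toPath t) (λ ()) (λ ()) (diagonalWrapPair b k) (toPath-weighted t)

toPath-injective : ∀ {n} (t t' : Skeleton n) → toPath t ≡ toPath t' → t ≡ t'
toPath-injective nil nil _ = refl
toPath-injective (snocD1 t) (snocD1 t') e = cong snocD1 (toPath-injective t t' (List.∷ʳ-injectiveˡ (toPath t) (toPath t') e))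
toPath-injective (wrapNE t) (wrapNE t') e =
  cong wrapNE (toPath-injective t t' (proj₂ (List.∷-injective (List.∷ʳ-injectiveˡ (_ ∷ toPath t) (_ ∷ toPath t') e))))
toPath-injective (wrapEN t) (wrapEN t') e =
  cong wrapEN (toPath-injective t t' (proj₂ (List.∷-injective (List.∷ʳ-injectiveˡ (_ ∷ toPath t) (_ ∷ toPath t') e))))
toPath-injective (wrapDD b k t) (wrapDD b' k' t') e
  with List.∷-injective (List.∷ʳ-injectiveˡ (_ ∷ toPath t) (_ ∷ toPath t') e)
... | first≡ , rest≡ with pairIndex-injective b b' k k' (ℕ.suc-injective (ℕ.suc-injective (cong label first≡)))
... | refl , refl = cong (wrapDD b k) (toPath-injective t t' rest≡)
toPath-injective (snocD1 t) (wrapNE t') e with List.∷ʳ-injectiveʳ (toPath t) (_ ∷ toPath t') e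
... | ()
toPath-injective (snocD1 t) (wrapEN t') e with List.∷ʳ-injectiveʳ (toPath t) (_ ∷ toPath t') e
... | ()
toPath-injective (snocD1 t) (wrapDD _ _ t') e with List.∷ʳ-injectiveʳ (toPath t) (_ ∷ toPath t') e
... | ()
toPath-injective (wrapNE t) (snocD1 t') e with List.∷ʳ-injectiveʳ (_ ∷ toPath t) (toPath t') e
... | ()
toPath-injective (wrapNE t) (wrapEN t') e with List.∷ʳ-injectiveʳ (_ ∷ toPath t) (_ ∷ toPath t') e
... | ()
toPath-injective (wrapNE t) (wrapDD _ _ t') e with List.∷ʳ-injectiveʳ (_ ∷ toPath t) (_ ∷ toPath t') e
... | ()
toPath-injective (wrapEN t) (snocD1 t') e with List.∷ʳ-injectiveʳ (_ ∷ toPath t) (toPath t') e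
... | ()
toPath-injective (wrapEN t) (wrapNE t') e with List.∷ʳ-injectiveʳ (_ ∷ toPath t) (_ ∷ toPath t') e
... | ()
toPath-injective (wrapEN t) (wrapDD _ _ t') e with List.∷ʳ-injectiveʳ (_ ∷ toPath t) (_ ∷ toPath t') e
... | ()
toPath-injective (wrapDD _ _ t) (snocD1 t') e with List.∷ʳ-injectiveʳ (_ ∷ toPath t) (toPath t') e
... | ()
toPath-injective (wrapDD _ _ t) (wrapNE t') e with List.∷ʳ-injectiveʳ (_ ∷ toPath t) (_ ∷ toPath t') e
... | ()
toPath-injective (wrapDD _ _ t) (wrapEN t') e with List.∷ʳ-injectiveʳ (_ ∷ toPath t) (_ ∷ toPath t') e
... | ()

module Outermost {m f x} (M : List Step) (¬f : ¬ IsD1 f) (¬x : ¬ IsD1 x)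
                 (w : IsWeightedDelannoy′ (suc m) (f ∷ M ++ [ x ])) where

  private
    W' : List Step
    W' = f ∷ M ++ [ x ]

    T : ℕ
    T = suc (suc (tOf M))

    w' : IsWeightedDelannoyAt (suc m) W' (idx W') T
    w' = subst (IsWeightedDelannoyAt _ W' (idx W')) (tOf-wrap M ¬f ¬x) w

    open IsWeightedDelannoyAt w'
    open WrappedPositions (idx-wrap M ¬f ¬x)

    mirror-first : idx W' (T + 1 ∸ 1) ≡ suc (suc (length M))
    mirror-first = trans (cong (idx W') (ℕ.m+n∸n≡m T 1)) ι'-last

  labelOK-first : LabelOK f
  labelOK-first = labels 1 (s≤s z≤n) (s≤s z≤n)

  labelOK-last : LabelOK x
  labelOK-last = subst LabelOK (at-∷ʳ M x)
    (labels (suc (suc (length M))) (s≤s z≤n) (ℕ.≤-reflexive (sym (cong suc (length-∷ʳ M x)))))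

  private
    last-letter : ∀ {L L'} → LettersMirror W' (idx W') T L L' → letter f ≡ L → letter x ≡ L'
    last-letter {L} {L'} mirror e = subst (λ s → letter s ≡ L') (at-∷ʳ M x)
      (subst (λ z → letter (at W' z) ≡ L') mirror-first
        (mirror 1 (s≤s z≤n) (s≤s z≤n) (subst (λ z → letter (at W' z) ≡ L) (sym ι'-first) e)))

  letter-last-E : letter f ≡ N → letter x ≡ E
  letter-last-E = last-letter NtoE

  letter-last-N : letter f ≡ E → letter x ≡ N
  letter-last-N = last-letter EtoN

  outer-diagonalPair : label f ≢ 1 → DiagonalPair (suc m) W' 1 (suc (suc (length M)))
  outer-diagonalPair l≢1 = subst₂ (DiagonalPair (suc m) W') ι'-first mirror-first
    (weights 1 (s≤s z≤n) (subst (1 ≤_) (sym (half-suc-suc (tOf M))) (s≤s z≤n))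
      (subst (λ z → label (at W' z) ≢ 1) (sym ι'-first) l≢1))

outer-weightEquation : ∀ m a b M →
  WeightEquation (suc m) ((D , suc (suc a)) ∷ M ++ [ (D , suc (suc b)) ]) 1 (suc (suc (length M))) →
  suc (a + b) ≡ 2 * m
outer-weightEquation m a b M e rewrite at-∷ʳ M (D , suc (suc b)) | drop-suc-length M [ (D , suc (suc b)) ] =
  ℕ.+-cancelˡ-≡ 5 _ _ (trans (sym (solve a b)) (trans e (solve′ m)))
  where solve : ∀ a b → suc (suc b) + (2 * (1 + 0 + 0) + suc (suc a)) ≡ 5 + suc (a + b)
        solve = solve-∀
        solve′ : ∀ m → 2 * suc m + 3 ≡ 5 + 2 * m
        solve′ = solve-∀

1+a+b≡2*m⇒ : ∀ {m a b} → suc (a + b) ≡ 2 * m → Σ ℕ λ m₁ → m ≡ suc m₁ × a + b ≡ 2 * m₁ + 1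
1+a+b≡2*m⇒ {suc m₁} e = m₁ , refl , ℕ.suc-injective (trans e (solve m₁))
  where solve : ∀ m → 2 * suc m ≡ suc (2 * m + 1)
        solve = solve-∀

letterN⇒ : ∀ s → letter s ≡ N → LabelOK s → s ≡ (N , 1)
letterN⇒ (N , l) _ l≡1 = cong (N ,_) l≡1

letterE⇒ : ∀ s → letter s ≡ E → LabelOK s → s ≡ (E , 1)
letterE⇒ (E , l) _ l≡1 = cong (E ,_) l≡1

letterD⇒ : ∀ s → letter s ≡ D → LabelOK s → ¬ IsD1 s → Σ ℕ λ b → s ≡ (D , suc (suc b))
letterD⇒ (D , suc zero)    _ _ ¬d = ⊥-elim (¬d isD1)
letterD⇒ (D , suc (suc b)) _ _ _  = b , refl

outerPair : ∀ {m} M f x → ¬ IsD1 f → ¬ IsD1 x → IsWeightedDelannoy′ (suc m) (f ∷ M ++ [ x ]) →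
            Σ ℕ λ n → WrapPair n f x (suc m)
outerPair {m} M (N , l) x ¬f ¬x w
  with labelOK-first | letterE⇒ x (letter-last-E refl) labelOK-last where open Outermost M ¬f ¬x w
... | refl | refl = m , pairNE
outerPair {m} M (E , l) x ¬f ¬x w
  with labelOK-first | letterN⇒ x (letter-last-N refl) labelOK-last where open Outermost M ¬f ¬x w
... | refl | refl = m , pairEN
outerPair M (D , zero) x ¬f ¬x w with Outermost.labelOK-first M ¬f ¬x w
... | ()
outerPair M (D , suc zero) x ¬f ¬x w = ⊥-elim (¬f isD1)
outerPair {m} M (D , suc (suc a)) x ¬f ¬x w
  with outer-diagonalPair (λ ()) | labelOK-last where open Outermost M ¬f ¬x w
... | isD , eq | labx with letterD⇒ x (subst (λ s → letter s ≡ D) (at-∷ʳ M x) isD) labx ¬x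
...   | b , refl with 1+a+b≡2*m⇒ {m} {a} {b} (outer-weightEquation m a b M eq)
...     | m₁ , refl , a+b≡ = m₁ , pairDD a b a+b≡

wrapPair-size< : ∀ {n f g n'} → WrapPair n f g n' → n < n'
wrapPair-size< pairNE         = ℕ.n<1+n _
wrapPair-size< pairEN         = ℕ.n<1+n _
wrapPair-size< (pairDD _ _ _) = ℕ.m<n⇒m<1+n (ℕ.n<1+n _)

wrapSkeleton : ∀ {n f g n'} → WrapPair n f g n' → (t : Skeleton n) →
               Σ (Skeleton n') λ s → toPath s ≡ f ∷ toPath t ++ [ g ]
wrapSkeleton pairNE t = wrapNE t , refl
wrapSkeleton pairEN t = wrapEN t , refl
wrapSkeleton {n} (pairDD a b a+b≡) t with pairIndex-surjective {n} a (subst (a ≤_) a+b≡ (ℕ.m≤m+n a b))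
... | c , k , refl = wrapDD c k t , cong (λ z → _ ∷ toPath t ++ [ (D , suc (suc z)) ]) b≡
  where
  b≡ : 2 * n + 1 ∸ pairIndex c k ≡ b
  b≡ = trans (cong (_∸ pairIndex c k) (sym a+b≡)) (ℕ.m+n∸m≡n (pairIndex c k) b)

size-zero : ∀ W → #N W + #D W ≡ 0 → #E W + #D W ≡ 0 → W ≡ []
size-zero []              _  _  = refl
size-zero ((N , _) ∷ W)   () _
size-zero ((E , _) ∷ W)   _  ()
size-zero ((D , _) ∷ W)   e  _  = ⊥-elim (ℕ.1+n≢0 (trans (sym (ℕ.+-suc (#N W) (#D W))) e))

single-¬weighted : ∀ {n x} → ¬ IsD1 x → ¬ IsWeightedDelannoy′ n [ x ]
single-¬weighted ¬x w with subst (λ ps → length ps % 2 ≡ 0) (nonD1From-single 1 ¬x) (IsWeightedDelannoyAt.tEven w)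
... | ()

-- The first step, (D,1), would have to come after the position i_{t/2} ≥ 1.
firstD1-¬weighted : ∀ {n} M {x} → ¬ IsD1 x → ¬ IsWeightedDelannoy′ n (D1 ∷ M ++ [ x ])
firstD1-¬weighted M {x} ¬x w = ℕ.<-irrefl refl (ℕ.≤-trans (s≤s 1≤ι) (d1After 1 (s≤s z≤n) (s≤s z≤n) isD1))
  where
  open IsWeightedDelannoyAt w
  W = D1 ∷ M ++ [ x ]
  positions : nonD1Pos W ≡ nonD1From 2 M ++ [ 2 + length M ]
  positions = trans (nonD1From-++ 2 M [ x ]) (cong (nonD1From 2 M ++_) (nonD1From-single (2 + length M) ¬x))
  1≤t : 1 ≤ tOf W
  1≤t = subst (1 ≤_) (sym (trans (cong length positions) (length-∷ʳ (nonD1From 2 M) _))) (s≤s z≤n)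
  1≤t/2 : 1 ≤ tOf W / 2
  1≤t/2 with tOf W | tEven | 1≤t
  ... | suc (suc t) | _ | _ = subst (1 ≤_) (sym (half-suc-suc t)) (s≤s z≤n)
  1≤ι : 1 ≤ idx W (tOf W / 2)
  1≤ι = proj₁ (PositionsIn.ι-bounds (idx-positionsIn W) (tOf W / 2) 1≤t/2 (m/n≤m (tOf W) 2))

Decodes : ℕ → Set
Decodes n = ∀ W → IsWeightedDelannoy′ n W → Σ (Skeleton n) λ t → toPath t ≡ W

decode-step : ∀ n → (∀ {m} → m < n → Decodes m) → Decodes n
decode-step zero _ W w = nil , sym (size-zero W countNE countED)
  where open IsWeightedDelannoyAt w
decode-step (suc m) rec W w with initLast W
... | [] = ⊥-elim (ℕ.0≢1+n (IsWeightedDelannoyAt.countNE w))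
... | M ∷ʳ′ x with isD1? x
...   | yes isD1 with rec ℕ.≤-refl M (snocD1-reflects M w)
...     | t , refl = snocD1 t , refl
decode-step (suc m) rec W w | [] ∷ʳ′ x | no ¬x = ⊥-elim (single-¬weighted ¬x w)
decode-step (suc m) rec W w | (f ∷ M) ∷ʳ′ x | no ¬x with isD1? f
... | yes isD1 = ⊥-elim (firstD1-¬weighted M ¬x w)
... | no ¬f with outerPair M f x ¬f ¬x w
...   | n , wr with rec (wrapPair-size< wr) M (wrap-reflects M ¬f ¬x wr w)
...     | t , refl = wrapSkeleton wr t

decode : ∀ n → Decodes n
decode = <-rec Decodes decode-step

skeletons↔paths : ∀ n → Inverse (setoid (Skeleton n)) (WeightedDelannoySetoid n)
skeletons↔paths n = record
  { to        = λ t → toPath t , toIsWeightedDelannoy (toPath-weighted t)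
  ; from      = λ (W , w) → proj₁ (decode n W (fromIsWeightedDelannoy w))
  ; to-cong   = cong toPath
  ; from-cong = λ {w} {w'} e → toPath-injective _ _ (trans (decoded w) (trans e (sym (decoded w'))))
  ; inverse   = (λ {w} e → trans (cong toPath e) (decoded w))
              , (λ {_} {w} e → toPath-injective _ _ (trans (decoded w) e))
  }
  where
  decoded : ∀ ((W , w) : WeightedDelannoy n) → toPath (proj₁ (decode n W (fromIsWeightedDelannoy w))) ≡ W
  decoded (W , w) = proj₂ (decode n W (fromIsWeightedDelannoy w))

-- Halves of skew-symmetric clans

-- A symbol of the left half of a clan.  A number there is matched at its
-- mirror position (mirrored), at the left position j (pairedWith false j), or
-- at the mirror of the left position j (pairedWith true j).
data HalfSym (n : ℕ) : Set where
  plus minus mirrored : HalfSym n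
  pairedWith : Bool → Fin n → HalfSym n

Half : ℕ → Set
Half n = Fin n → HalfSym n

PointsBack : ∀ {n} → Half n → Fin n → HalfSym n → Set
PointsBack h i (pairedWith b j) = i ≢ j × h j ≡ pairedWith b i
PointsBack h i _                = ⊤

IsValidHalf : ∀ {n} → Half n → Set
IsValidHalf h = ∀ i → PointsBack h i (h i)

data Unpaired {n : ℕ} : HalfSym n → Set where
  plus     : Unpaired plus
  minus    : Unpaired minus
  mirrored : Unpaired mirrored

unpaired-pointsBack : ∀ {n} {h : Half n} {i s} → Unpaired s → PointsBack h i s
unpaired-pointsBack plus     = tt
unpaired-pointsBack minus    = tt
unpaired-pointsBack mirrored = tt

shift : ∀ {n} → HalfSym n → HalfSym (suc n)
shift plus             = plus
shift minus            = minus
shift mirrored         = mirrored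
shift (pairedWith b j) = pairedWith b (suc j)

unshift : ∀ {n} → HalfSym (suc n) → HalfSym n
unshift (pairedWith b zero)    = plus
unshift (pairedWith b (suc j)) = pairedWith b j
unshift plus                   = plus
unshift minus                  = minus
unshift mirrored               = mirrored

unshift-shift : ∀ {n} (x : HalfSym n) → unshift (shift x) ≡ x
unshift-shift plus             = refl
unshift-shift minus            = refl
unshift-shift mirrored         = refl
unshift-shift (pairedWith b j) = refl

shift-unshift : ∀ {n} (x : HalfSym (suc n)) → (∀ b → x ≢ pairedWith b zero) → shift (unshift x) ≡ x
shift-unshift plus                   _  = refl
shift-unshift minus                  _  = refl
shift-unshift mirrored               _  = refl
shift-unshift (pairedWith b zero)    ≢0 = ⊥-elim (≢0 b refl)
shift-unshift (pairedWith b (suc j)) _  = refl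

_◂_ : ∀ {n} → HalfSym (suc n) → Half n → Half (suc n)
(s ◂ h) zero    = s
(s ◂ h) (suc i) = shift (h i)

◂-valid : ∀ {n} {s} {h : Half n} → Unpaired s → IsValidHalf h → IsValidHalf (s ◂ h)
◂-valid u valid zero = unpaired-pointsBack u
◂-valid {h = h} u valid (suc i) with h i | valid i
... | plus           | _      = tt
... | minus          | _      = tt
... | mirrored       | _      = tt
... | pairedWith b j | i≢j , e = i≢j ∘ suc-injective , cong shift e

punchInSym : ∀ {n} → Fin (suc n) → HalfSym n → HalfSym (suc (suc n))
punchInSym k (pairedWith b p) = pairedWith b (suc (punchIn k p))
punchInSym k plus             = plus
punchInSym k minus            = minus
punchInSym k mirrored         = mirrored

punchOutSym : ∀ {n} → Fin (suc n) → HalfSym (suc (suc n)) → HalfSym n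
punchOutSym k (pairedWith b zero)    = plus
punchOutSym k (pairedWith b (suc p)) with k ≟ p
... | yes _   = plus
... | no k≢p  = pairedWith b (punchOut k≢p)
punchOutSym k plus                   = plus
punchOutSym k minus                  = minus
punchOutSym k mirrored               = mirrored

punchOutSym-pairedWith : ∀ {n} (k : Fin (suc n)) b p (k≢p : k ≢ p) →
                         punchOutSym k (pairedWith b (suc p)) ≡ pairedWith b (punchOut k≢p)
punchOutSym-pairedWith k b p k≢p with k ≟ p
... | yes k≡p = ⊥-elim (k≢p k≡p)
... | no _    = cong (pairedWith b) (punchOut-cong k refl)

punchOutSym-punchInSym : ∀ {n} (k : Fin (suc n)) x → punchOutSym k (punchInSym k x) ≡ x
punchOutSym-punchInSym k plus             = refl
punchOutSym-punchInSym k minus            = refl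
punchOutSym-punchInSym k mirrored         = refl
punchOutSym-punchInSym k (pairedWith b p) =
  trans (punchOutSym-pairedWith k b (punchIn k p) (punchInᵢ≢i k p ∘ sym))
        (cong (pairedWith b) (trans (punchOut-cong k refl) (punchOut-punchIn k)))

punchInSym-punchOutSym : ∀ {n} (k : Fin (suc n)) x →
                         (∀ b → x ≢ pairedWith b zero) → (∀ b → x ≢ pairedWith b (suc k)) →
                         punchInSym k (punchOutSym k x) ≡ x
punchInSym-punchOutSym k plus     _ _ = refl
punchInSym-punchOutSym k minus    _ _ = refl
punchInSym-punchOutSym k mirrored _ _ = refl
punchInSym-punchOutSym k (pairedWith b zero) ≢0 _ = ⊥-elim (≢0 b refl)
punchInSym-punchOutSym k (pairedWith b (suc p)) _ ≢k with k ≟ p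
... | yes refl = ⊥-elim (≢k b refl)
... | no k≢p   = cong (pairedWith b ∘ suc) (punchIn-punchOut k≢p)

pairFirst : ∀ {n} → Bool → Fin (suc n) → Half n → Half (suc (suc n))
pairFirst b k h zero = pairedWith b (suc k)
pairFirst b k h (suc i) with k ≟ i
... | yes _  = pairedWith b zero
... | no k≢i = punchInSym k (h (punchOut k≢i))

pairFirst-partner : ∀ {n} b (k : Fin (suc n)) h → pairFirst b k h (suc k) ≡ pairedWith b zero
pairFirst-partner b k h with k ≟ k
... | yes _   = refl
... | no k≢k  = ⊥-elim (k≢k refl)

pairFirst-punchIn : ∀ {n} b (k : Fin (suc n)) h i → pairFirst b k h (suc (punchIn k i)) ≡ punchInSym k (h i)
pairFirst-punchIn b k h i with k ≟ punchIn k i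
... | yes k≡ = ⊥-elim (punchInᵢ≢i k i (sym k≡))
... | no _   = cong (punchInSym k ∘ h) (trans (punchOut-cong k refl) (punchOut-punchIn k))

pairFirst-valid : ∀ {n} b (k : Fin (suc n)) {h : Half n} → IsValidHalf h → IsValidHalf (pairFirst b k h)
pairFirst-valid b k {h} valid zero = (λ ()) , pairFirst-partner b k h
pairFirst-valid b k {h} valid (suc i) with k ≟ i
... | yes refl = (λ ()) , refl
... | no k≢i with h (punchOut k≢i) | valid (punchOut k≢i) | punchIn-punchOut k≢i
...   | plus            | _        | _  = tt
...   | minus           | _        | _  = tt
...   | mirrored        | _        | _  = tt
...   | pairedWith b' p | i'≢p , e | pp =
  (λ q → i'≢p (punchIn-injective k _ _ (trans pp (suc-injective q)))) ,
  trans (pairFirst-punchIn b k h p) (trans (cong (punchInSym k) e) (cong (pairedWith b' ∘ suc) pp))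

unpaired≢pairedWith : ∀ {n} {s : HalfSym n} {b j} → Unpaired s → s ≢ pairedWith b j
unpaired≢pairedWith plus     ()
unpaired≢pairedWith minus    ()
unpaired≢pairedWith mirrored ()

tailHalf : ∀ {n} → Half (suc n) → Half n
tailHalf h i = unshift (h (suc i))

innerHalf : ∀ {n} → Fin (suc n) → Half (suc (suc n)) → Half n
innerHalf k h i = punchOutSym k (h (suc (punchIn k i)))

module _ {n} {h : Half (suc n)} (valid : IsValidHalf h) (first : Unpaired (h zero)) where

  private
    notPairedWithFirst : ∀ i b → h (suc i) ≢ pairedWith b zero
    notPairedWithFirst i b e = unpaired≢pairedWith first (proj₂ (subst (PointsBack h (suc i)) e (valid (suc i))))

  shift-tailHalf : ∀ i → shift (tailHalf h i) ≡ h (suc i)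
  shift-tailHalf i = shift-unshift (h (suc i)) (notPairedWithFirst i)

  tailHalf-valid : IsValidHalf (tailHalf h)
  tailHalf-valid i with h (suc i) | valid (suc i) | notPairedWithFirst i
  ... | plus                   | _       | _  = tt
  ... | minus                  | _       | _  = tt
  ... | mirrored               | _       | _  = tt
  ... | pairedWith b zero      | _       | ≢0 = ⊥-elim (≢0 b refl)
  ... | pairedWith b (suc j)   | i≢j , e | _  = i≢j ∘ cong suc , cong unshift e

module _ {n} {h : Half (suc (suc n))} (valid : IsValidHalf h) {b k} (first : h zero ≡ pairedWith b (suc k)) where

  partner-pointsBack : h (suc k) ≡ pairedWith b zero
  partner-pointsBack = proj₂ (subst (PointsBack h zero) first (valid zero))

  private
    pointsBack : ∀ i {b' j} → h (suc i) ≡ pairedWith b' j → h j ≡ pairedWith b' (suc i)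
    pointsBack i e = proj₂ (subst (PointsBack h (suc i)) e (valid (suc i)))

    notPairedWithFirst : ∀ i → k ≢ i → ∀ b' → h (suc i) ≢ pairedWith b' zero
    notPairedWithFirst i k≢i b' e with trans (sym (pointsBack i e)) first
    ... | refl = k≢i refl

    notPairedWithPartner : ∀ i → k ≢ i → ∀ b' → h (suc i) ≢ pairedWith b' (suc k)
    notPairedWithPartner i k≢i b' e with trans (sym partner-pointsBack) (pointsBack i e)
    ... | ()

  punchInSym-innerHalf : ∀ i (k≢i : k ≢ i) → punchInSym k (innerHalf k h (punchOut k≢i)) ≡ h (suc i)
  punchInSym-innerHalf i k≢i =
    trans (cong (λ z → punchInSym k (punchOutSym k (h (suc z)))) (punchIn-punchOut k≢i))
          (punchInSym-punchOutSym k (h (suc i)) (notPairedWithFirst i k≢i) (notPairedWithPartner i k≢i))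

  innerHalf-valid : IsValidHalf (innerHalf k h)
  innerHalf-valid i
    with h (suc (punchIn k i)) | valid (suc (punchIn k i))
       | notPairedWithFirst (punchIn k i) (punchInᵢ≢i k i ∘ sym)
       | notPairedWithPartner (punchIn k i) (punchInᵢ≢i k i ∘ sym)
  ... | plus                  | _       | _  | _  = tt
  ... | minus                 | _       | _  | _  = tt
  ... | mirrored              | _       | _  | _  = tt
  ... | pairedWith b' zero    | _       | ≢0 | _  = ⊥-elim (≢0 b' refl)
  ... | pairedWith b' (suc p) | i≢p , e | _  | ≢k with k ≟ p
  ...   | yes refl = ⊥-elim (≢k b' refl)
  ...   | no k≢p   =
    (λ q → i≢p (cong suc (trans (cong (punchIn k) q) (punchIn-punchOut k≢p)))) ,
    trans (cong (λ z → punchOutSym k (h (suc z))) (punchIn-punchOut k≢p))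
      (trans (cong (punchOutSym k) e)
        (trans (punchOutSym-pairedWith k b' (punchIn k i) (punchInᵢ≢i k i ∘ sym))
          (cong (pairedWith b') (trans (punchOut-cong k refl) (punchOut-punchIn k)))))

toHalf : ∀ {n} → Skeleton n → Half n
toHalf nil            ()
toHalf (snocD1 t)     = plus ◂ toHalf t
toHalf (wrapNE t)     = minus ◂ toHalf t
toHalf (wrapEN t)     = mirrored ◂ toHalf t
toHalf (wrapDD b k t) = pairFirst b k (toHalf t)

toHalf-valid : ∀ {n} (t : Skeleton n) → IsValidHalf (toHalf t)
toHalf-valid nil            ()
toHalf-valid (snocD1 t)     = ◂-valid plus (toHalf-valid t)
toHalf-valid (wrapNE t)     = ◂-valid minus (toHalf-valid t)
toHalf-valid (wrapEN t)     = ◂-valid mirrored (toHalf-valid t)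
toHalf-valid (wrapDD b k t) = pairFirst-valid b k (toHalf-valid t)

fromHalf     : ∀ n → Half n → Skeleton n
fromHalfWith : ∀ n → Half (suc n) → HalfSym (suc n) → Skeleton (suc n)

fromHalf zero    h = nil
fromHalf (suc n) h = fromHalfWith n h (h zero)

-- The clause for pairedWith b zero is junk: in a valid half the first
-- position is never paired with itself.
fromHalfWith n       h plus                   = snocD1 (fromHalf n (tailHalf h))
fromHalfWith n       h minus                  = wrapNE (fromHalf n (tailHalf h))
fromHalfWith n       h mirrored               = wrapEN (fromHalf n (tailHalf h))
fromHalfWith n       h (pairedWith b zero)    = snocD1 (fromHalf n (tailHalf h))
fromHalfWith (suc n) h (pairedWith b (suc k)) = wrapDD b k (fromHalf n (innerHalf k h))

fromHalf-cong     : ∀ n {h h' : Half n} → h ≗ h' → fromHalf n h ≡ fromHalf n h'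
fromHalfWith-cong : ∀ n {h h' : Half (suc n)} → h ≗ h' → ∀ x → fromHalfWith n h x ≡ fromHalfWith n h' x

fromHalf-cong zero    e = refl
fromHalf-cong (suc n) {h} {h'} e rewrite e zero = fromHalfWith-cong n e (h' zero)

fromHalfWith-cong n       e plus                   = cong snocD1 (fromHalf-cong n (cong unshift ∘ e ∘ suc))
fromHalfWith-cong n       e minus                  = cong wrapNE (fromHalf-cong n (cong unshift ∘ e ∘ suc))
fromHalfWith-cong n       e mirrored               = cong wrapEN (fromHalf-cong n (cong unshift ∘ e ∘ suc))
fromHalfWith-cong n       e (pairedWith b zero)    = cong snocD1 (fromHalf-cong n (cong unshift ∘ e ∘ suc))
fromHalfWith-cong (suc n) e (pairedWith b (suc k)) =
  cong (wrapDD b k) (fromHalf-cong n (cong (punchOutSym k) ∘ e ∘ suc ∘ punchIn k))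

fromHalf-toHalf : ∀ {n} (t : Skeleton n) → fromHalf n (toHalf t) ≡ t
fromHalf-toHalf nil = refl
fromHalf-toHalf (snocD1 t) = cong snocD1 (trans (fromHalf-cong _ (unshift-shift ∘ toHalf t)) (fromHalf-toHalf t))
fromHalf-toHalf (wrapNE t) = cong wrapNE (trans (fromHalf-cong _ (unshift-shift ∘ toHalf t)) (fromHalf-toHalf t))
fromHalf-toHalf (wrapEN t) = cong wrapEN (trans (fromHalf-cong _ (unshift-shift ∘ toHalf t)) (fromHalf-toHalf t))
fromHalf-toHalf (wrapDD b k t) = cong (wrapDD b k) (trans (fromHalf-cong _ inner) (fromHalf-toHalf t))
  where
  inner : innerHalf k (pairFirst b k (toHalf t)) ≗ toHalf t
  inner i = trans (cong (punchOutSym k) (pairFirst-punchIn b k (toHalf t) i)) (punchOutSym-punchInSym k (toHalf t i))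

toHalf-fromHalf     : ∀ n {h : Half n} → IsValidHalf h → toHalf (fromHalf n h) ≗ h
toHalf-fromHalfWith : ∀ n {h : Half (suc n)} → IsValidHalf h → ∀ {x} → h zero ≡ x → toHalf (fromHalfWith n h x) ≗ h

unpaired◂toHalf-fromHalf : ∀ n {h : Half (suc n)} → IsValidHalf h → ∀ {s} → Unpaired s → h zero ≡ s →
                           (s ◂ toHalf (fromHalf n (tailHalf h))) ≗ h

toHalf-fromHalf zero    valid ()
toHalf-fromHalf (suc n) valid = toHalf-fromHalfWith n valid refl

toHalf-fromHalfWith n valid {plus}     = unpaired◂toHalf-fromHalf n valid plus
toHalf-fromHalfWith n valid {minus}    = unpaired◂toHalf-fromHalf n valid minus
toHalf-fromHalfWith n valid {mirrored} = unpaired◂toHalf-fromHalf n valid mirrored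
toHalf-fromHalfWith n valid {pairedWith b zero} first = ⊥-elim (proj₁ (subst (PointsBack _ zero) first (valid zero)) refl)
toHalf-fromHalfWith (suc n) valid {pairedWith b (suc k)} first zero = sym first
toHalf-fromHalfWith (suc n) {h} valid {pairedWith b (suc k)} first (suc i) with k ≟ i
... | yes refl = sym (partner-pointsBack valid first)
... | no k≢i   = trans (cong (punchInSym k) (toHalf-fromHalf n (innerHalf-valid valid first) (punchOut k≢i)))
                      (punchInSym-innerHalf valid first i k≢i)

unpaired◂toHalf-fromHalf n valid u first zero    = sym first
unpaired◂toHalf-fromHalf n valid u refl  (suc i) =
  trans (cong shift (toHalf-fromHalf n (tailHalf-valid valid u) i)) (shift-tailHalf valid u i)

ValidHalfSetoid : ℕ → Setoid _ _
ValidHalfSetoid n = On.setoid (Fin n →-setoid HalfSym n) (proj₁ {B = IsValidHalf})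

skeletons↔validHalves : ∀ n → Inverse (setoid (Skeleton n)) (ValidHalfSetoid n)
skeletons↔validHalves n = record
  { to        = λ t → toHalf t , toHalf-valid t
  ; from      = λ (h , _) → fromHalf n h
  ; to-cong   = λ { refl _ → refl }
  ; from-cong = fromHalf-cong n
  ; inverse   = (λ { {_ , valid} refl → toHalf-fromHalf n valid })
              , (λ {t} e → trans (fromHalf-cong n e) (fromHalf-toHalf t))
  }

-- Skew-symmetric clans

opposite-injective : ∀ {m} {x y : Fin m} → opposite x ≡ opposite y → x ≡ y
opposite-injective {x = x} {y} e = trans (sym (opposite-involutive x)) (trans (cong opposite e) (opposite-involutive y))

negRev-involutive : ∀ {m} (s : Sym m) → negRev (negRev s) ≡ s
negRev-involutive plus   = refl
negRev-involutive minus  = refl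
negRev-involutive (pr j) = cong pr (opposite-involutive j)

module _ {n : ℕ} where

  left : Fin n → Fin (2 * n)
  left i = i ↑ˡ (n + 0)

  right : Fin n → Fin (2 * n)
  right = opposite ∘ left

  toℕ-left : ∀ i → toℕ (left i) ≡ toℕ i
  toℕ-left i = toℕ-↑ˡ i (n + 0)

  left-injective : ∀ {i j} → left i ≡ left j → i ≡ j
  left-injective {i} {j} e = toℕ-injective (trans (sym (toℕ-left i)) (trans (cong toℕ e) (toℕ-left j)))

  right-injective : ∀ {i j} → right i ≡ right j → i ≡ j
  right-injective = left-injective ∘ opposite-injective

  private
    2*n≡n+n : 2 * n ≡ n + n
    2*n≡n+n = cong (n +_) (ℕ.+-identityʳ n)

    n≤toℕ-right : ∀ j → n ≤ toℕ (right j)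
    n≤toℕ-right j rewrite opposite-prop (left j) | toℕ-left j | 2*n≡n+n =
      subst (n ≤_) (sym (ℕ.+-∸-assoc n (toℕ<n j))) (ℕ.m≤m+n n (n ∸ suc (toℕ j)))

    toℕ-opposite<n : ∀ (x : Fin (2 * n)) → n ≤ toℕ x → toℕ (opposite x) < n
    toℕ-opposite<n x n≤x = ℕ.≰⇒> λ n≤x' → ℕ.<-irrefl refl (ℕ.≤-trans (ℕ.+-cancelˡ-≤ n (suc (toℕ x)) n (chain n≤x')) n≤x)
      where
      chain : n ≤ toℕ (opposite x) → n + suc (toℕ x) ≤ n + n
      chain n≤x' = ℕ.≤-trans (ℕ.+-monoˡ-≤ (suc (toℕ x)) (subst (n ≤_) (opposite-prop x) n≤x'))
                     (ℕ.≤-reflexive (trans (ℕ.m∸n+n≡m (toℕ<n x)) 2*n≡n+n))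

  left≢right : ∀ i j → left i ≢ right j
  left≢right i j e = ℕ.<-irrefl refl (ℕ.<-≤-trans (subst (_< n) (sym (toℕ-left i)) (toℕ<n i))
                       (subst (λ z → n ≤ toℕ z) (sym e) (n≤toℕ-right j)))

  Side : Fin (2 * n) → Set
  Side x = (Σ (Fin n) λ i → x ≡ left i) ⊎ (Σ (Fin n) λ i → x ≡ right i)

  side : ∀ x → Side x
  side x with toℕ x ℕ.<? n
  ... | yes x<n = inj₁ (fromℕ< x<n , toℕ-injective (trans (sym (toℕ-fromℕ< x<n)) (sym (toℕ-left (fromℕ< x<n)))))
  ... | no x≮n  = inj₂ (fromℕ< x'<n , trans (sym (opposite-involutive x)) (cong opposite
          (toℕ-injective (trans (sym (toℕ-fromℕ< x'<n)) (sym (toℕ-left (fromℕ< x'<n)))))))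
    where
    x'<n : toℕ (opposite x) < n
    x'<n = toℕ-opposite<n x (ℕ.≮⇒≥ x≮n)

leftSym : ∀ {n} → Fin n → HalfSym n → Sym (2 * n)
leftSym i plus              = plus
leftSym i minus             = minus
leftSym i mirrored          = pr (right i)
leftSym i (pairedWith false j) = pr (left j)
leftSym i (pairedWith true j)  = pr (right j)

symAt : ∀ {n} (h : Half n) {x : Fin (2 * n)} → Side x → Sym (2 * n)
symAt h (inj₁ (i , _)) = leftSym i (h i)
symAt h (inj₂ (i , _)) = negRev (leftSym i (h i))

toClan : ∀ {n} → Half n → Vec (Sym (2 * n)) (2 * n)
toClan h = tabulate (λ x → symAt h (side x))

lookup-toClan-left : ∀ {n} (h : Half n) i → lookup (toClan h) (left i) ≡ leftSym i (h i)
lookup-toClan-left h i = trans (lookup∘tabulate _ (left i)) (symAt-left (side (left i)) refl)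
  where
  symAt-left : ∀ {x} (s : Side x) → x ≡ left i → symAt h s ≡ leftSym i (h i)
  symAt-left (inj₁ (j , e)) refl rewrite left-injective e = refl
  symAt-left (inj₂ (j , e)) refl = ⊥-elim (left≢right i j e)

lookup-toClan-right : ∀ {n} (h : Half n) i → lookup (toClan h) (right i) ≡ negRev (leftSym i (h i))
lookup-toClan-right h i = trans (lookup∘tabulate _ (right i)) (symAt-right (side (right i)) refl)
  where
  symAt-right : ∀ {x} (s : Side x) → x ≡ right i → symAt h s ≡ negRev (leftSym i (h i))
  symAt-right (inj₁ (j , e)) refl = ⊥-elim (left≢right j i (sym e))
  symAt-right (inj₂ (j , e)) refl = cong (λ k → negRev (leftSym k (h k))) (sym (right-injective e))

toClan-skew : ∀ {n} (h : Half n) → IsSkewSymmetric (toClan h)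
toClan-skew {n} h x with side {n} x
... | inj₁ (i , refl) = trans (lookup-toClan-left h i)
        (trans (sym (negRev-involutive _)) (cong negRev (sym (lookup-toClan-right h i))))
... | inj₂ (i , refl) = trans (lookup-toClan-right h i)
        (cong negRev (trans (sym (lookup-toClan-left h i)) (cong (lookup (toClan h)) (sym (opposite-involutive (left i))))))

pairOK-opposite : ∀ {m} (v : Vec (Sym m) m) → IsSkewSymmetric v → ∀ x →
                  PairOK v x (lookup v x) → PairOK v (opposite x) (lookup v (opposite x))
pairOK-opposite v skew x ok with lookup v x in e
... | plus  rewrite skew (opposite x) | opposite-involutive x | e = tt
... | minus rewrite skew (opposite x) | opposite-involutive x | e = tt
... | pr p  rewrite skew (opposite x) | opposite-involutive x | e =
  fromWitnessFalse (toWitnessFalse (proj₁ ok) ∘ opposite-injective) ,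
  trans (skew (opposite p)) (trans (cong (negRev ∘ lookup v) (opposite-involutive p)) (cong negRev (proj₂ ok)))

toClan-pairOK-left : ∀ {n} {h : Half n} → IsValidHalf h → ∀ i → PairOK (toClan h) (left i) (lookup (toClan h) (left i))
toClan-pairOK-left {h = h} valid i rewrite lookup-toClan-left h i with h i in eq | valid i
... | plus               | _       = tt
... | minus              | _       = tt
... | mirrored           | _       = fromWitnessFalse (left≢right i i) ,
      trans (lookup-toClan-right h i) (trans (cong (negRev ∘ leftSym i) eq) (cong pr (opposite-involutive (left i))))
... | pairedWith false j | i≢j , e = fromWitnessFalse (i≢j ∘ left-injective) ,
      trans (lookup-toClan-left h j) (cong (leftSym j) e)
... | pairedWith true j  | i≢j , e = fromWitnessFalse (left≢right i j) ,
      trans (lookup-toClan-right h j) (trans (cong (negRev ∘ leftSym j) e) (cong pr (opposite-involutive (left i))))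

toClan-pairOK : ∀ {n} {h : Half n} → IsValidHalf h → ∀ x → PairOK (toClan h) x (lookup (toClan h) x)
toClan-pairOK {n} {h} valid x with side {n} x
... | inj₁ (i , refl) = toClan-pairOK-left valid i
... | inj₂ (i , refl) = pairOK-opposite (toClan h) (toClan-skew h) (left i) (toClan-pairOK-left valid i)

isPlus isMinus : ∀ {k} → Sym k → ℕ
isPlus plus    = 1
isPlus _       = 0
isMinus minus  = 1
isMinus _      = 0

#plus≡sum : ∀ {k m} (v : Vec (Sym k) m) → #plus v ≡ sum (isPlus ∘ lookup v)
#plus≡sum []           = refl
#plus≡sum (plus ∷ v)   = cong suc (#plus≡sum v)
#plus≡sum (minus ∷ v)  = #plus≡sum v
#plus≡sum (pr _ ∷ v)   = #plus≡sum v

#minus≡sum : ∀ {k m} (v : Vec (Sym k) m) → #minus v ≡ sum (isMinus ∘ lookup v)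
#minus≡sum []          = refl
#minus≡sum (plus ∷ v)  = #minus≡sum v
#minus≡sum (minus ∷ v) = cong suc (#minus≡sum v)
#minus≡sum (pr _ ∷ v)  = #minus≡sum v

isPlus-negRev : ∀ {k} (s : Sym k) → isPlus (negRev s) ≡ isMinus s
isPlus-negRev plus   = refl
isPlus-negRev minus  = refl
isPlus-negRev (pr _) = refl

skew⇒#plus≡#minus : ∀ {m} (v : Vec (Sym m) m) → IsSkewSymmetric v → #plus v ≡ #minus v
skew⇒#plus≡#minus v skew = begin
  #plus v                                  ≡⟨ #plus≡sum v ⟩
  sum (isPlus ∘ lookup v)                  ≡⟨ sum-cong-≗ (cong isPlus ∘ skew) ⟩
  sum (isPlus ∘ negRev ∘ lookup v ∘ opposite) ≡⟨ sum-cong-≗ (isPlus-negRev ∘ lookup v ∘ opposite) ⟩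
  sum (isMinus ∘ lookup v ∘ opposite)      ≡⟨ sum-permute (isMinus ∘ lookup v) reverse ⟨
  sum (isMinus ∘ lookup v)                 ≡⟨ #minus≡sum v ⟨
  #minus v                                 ∎
  where open ≡-Reasoning

toHalfSymWith : ∀ {n} (i : Fin n) p → Dec (p ≡ right i) → Side p → HalfSym n
toHalfSymWith i p (yes _) _              = mirrored
toHalfSymWith i p (no _)  (inj₁ (j , _)) = pairedWith false j
toHalfSymWith i p (no _)  (inj₂ (j , _)) = pairedWith true j

toHalfSym : ∀ {n} → Fin n → Sym (2 * n) → HalfSym n
toHalfSym i plus   = plus
toHalfSym i minus  = minus
toHalfSym {n} i (pr p) = toHalfSymWith i p (p ≟ right i) (side {n} p)

fromClan : ∀ {n} → Vec (Sym (2 * n)) (2 * n) → Half n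
fromClan v i = toHalfSym i (lookup v (left i))

leftSym-toHalfSym : ∀ {n} (i : Fin n) s → leftSym i (toHalfSym i s) ≡ s
leftSym-toHalfSym i plus   = refl
leftSym-toHalfSym i minus  = refl
leftSym-toHalfSym {n} i (pr p) = go (p ≟ right i) (side {n} p)
  where
  go : ∀ d s → leftSym i (toHalfSymWith i p d s) ≡ pr p
  go (yes e) _              = cong pr (sym e)
  go (no _)  (inj₁ (j , e)) = cong pr (sym e)
  go (no _)  (inj₂ (j , e)) = cong pr (sym e)

toHalfSym-left : ∀ {n} (i j : Fin n) → toHalfSym i (pr (left j)) ≡ pairedWith false j
toHalfSym-left {n} i j = go (left j ≟ right i) (side {n} (left j))
  where
  go : ∀ d s → toHalfSymWith i (left j) d s ≡ pairedWith false j
  go (yes e)                 _ = ⊥-elim (left≢right j i e)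
  go (no _) (inj₁ (j' , e)) = cong (pairedWith false) (sym (left-injective e))
  go (no _) (inj₂ (j' , e)) = ⊥-elim (left≢right j j' e)

toHalfSym-right : ∀ {n} (i j : Fin n) → i ≢ j → toHalfSym i (pr (right j)) ≡ pairedWith true j
toHalfSym-right {n} i j i≢j = go (right j ≟ right i) (side {n} (right j))
  where
  go : ∀ d s → toHalfSymWith i (right j) d s ≡ pairedWith true j
  go (yes e)                 _ = ⊥-elim (i≢j (sym (right-injective e)))
  go (no _) (inj₁ (j' , e)) = ⊥-elim (left≢right j' j (sym e))
  go (no _) (inj₂ (j' , e)) = cong (pairedWith true) (sym (right-injective e))

toHalfSym-mirror : ∀ {n} (i : Fin n) → toHalfSym i (pr (right i)) ≡ mirrored
toHalfSym-mirror {n} i with right i ≟ right i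
... | yes _ = refl
... | no ≢  = ⊥-elim (≢ refl)

toHalfSym-leftSym : ∀ {n} {h : Half n} i x → PointsBack h i x → toHalfSym i (leftSym i x) ≡ x
toHalfSym-leftSym i plus                 _         = refl
toHalfSym-leftSym i minus                _         = refl
toHalfSym-leftSym i mirrored             _         = toHalfSym-mirror i
toHalfSym-leftSym i (pairedWith false j) _         = toHalfSym-left i j
toHalfSym-leftSym i (pairedWith true j)  (i≢j , _) = toHalfSym-right i j i≢j

fromClan-toClan : ∀ {n} {h : Half n} → IsValidHalf h → fromClan (toClan h) ≗ h
fromClan-toClan {h = h} valid i = trans (cong (toHalfSym i) (lookup-toClan-left h i)) (toHalfSym-leftSym i (h i) (valid i))

toClan-cong : ∀ {n} {h h' : Half n} → h ≗ h' → toClan h ≡ toClan h'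
toClan-cong {n} {h} {h'} e = tabulate-cong (λ x → symIsWeightedDelannoyAt-cong (side {n} x))
  where
  symIsWeightedDelannoyAt-cong : ∀ {x} (s : Side x) → symAt h s ≡ symAt h' s
  symIsWeightedDelannoyAt-cong (inj₁ (i , _)) = cong (leftSym i) (e i)
  symIsWeightedDelannoyAt-cong (inj₂ (i , _)) = cong (negRev ∘ leftSym i) (e i)

toClan-fromClan : ∀ {n} {v : Vec (Sym (2 * n)) (2 * n)} → IsSkewSymmetric v → toClan {n} (fromClan v) ≡ v
toClan-fromClan {n} {v} skew = trans (tabulate-cong (λ x → symAt-fromClan (side {n} x))) (tabulate∘lookup v)
  where
  symAt-fromClan : ∀ {x} (s : Side {n} x) → symAt (fromClan v) s ≡ lookup v x
  symAt-fromClan (inj₁ (i , refl)) = leftSym-toHalfSym i (lookup v (left i))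
  symAt-fromClan (inj₂ (i , refl)) = trans (cong negRev (leftSym-toHalfSym i (lookup v (left i))))
    (sym (trans (skew (right i)) (cong (negRev ∘ lookup v) (opposite-involutive (left i)))))

fromClan-valid : ∀ {n} {v : Vec (Sym (2 * n)) (2 * n)} → IsClan n v → IsSkewSymmetric v → IsValidHalf (fromClan v)
fromClan-valid {n} {v} (pairOK , _) skew i = pointsBack (lookup v (left i)) (pairOK (left i))
  where
  pointsBackWith : ∀ p d (s : Side {n} p) → False (left i ≟ p) → lookup v p ≡ pr (left i) →
                   PointsBack (fromClan v) i (toHalfSymWith i p d s)
  pointsBackWith p (yes _)   _                  _     _ = tt
  pointsBackWith p (no _)    (inj₁ (j , refl)) i≢p e = (λ i≡j → toWitnessFalse i≢p (cong left i≡j)) ,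
    trans (cong (toHalfSym j) e) (toHalfSym-left j i)
  pointsBackWith p (no p≢i') (inj₂ (j , refl)) _   e = (λ i≡j → p≢i' (cong right (sym i≡j))) ,
    trans (cong (toHalfSym j) (trans (skew (left j)) (cong negRev e))) (toHalfSym-right j i (λ j≡i → p≢i' (cong right j≡i)))
  pointsBack : ∀ s → PairOK v (left i) s → PointsBack (fromClan v) i (toHalfSym i s)
  pointsBack plus   _          = tt
  pointsBack minus  _          = tt
  pointsBack (pr p) (i≢p , e) = pointsBackWith p (p ≟ right i) (side {n} p) i≢p e

validHalves↔skewClans : ∀ n → Inverse (ValidHalfSetoid n) (SkewClanSetoid n)
validHalves↔skewClans n = record
  { to        = λ (h , valid) → toClan h , (toClan-pairOK valid , skew⇒#plus≡#minus (toClan h) (toClan-skew h)) , toClan-skew h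
  ; from      = λ (v , clan , skew) → fromClan v , fromClan-valid clan skew
  ; to-cong   = toClan-cong
  ; from-cong = λ e i → cong (λ v → fromClan v i) e
  ; inverse   = (λ { {_ , _ , skew} e → trans (toClan-cong e) (toClan-fromClan {n} skew) })
              , (λ { {_ , valid} refl → fromClan-toClan {n} valid })
  }

theorem4p2 : (n : ℕ) → 1 ≤ n →
    Bijection (WeightedDelannoySetoid n) (SkewClanSetoid n)
theorem4p2 n _ = Inverse⇒Bijection
  (Compose.inverse (Symmetry.inverse (skeletons↔paths n))
    (Compose.inverse (skeletons↔validHalves n) (validHalves↔skewClans n)))
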